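{- Let $M$ be a simple binary matroid, let $X$ be a modular copoint of $M$, and let $D$ be the complement of $X$ in the ground set. If $\mathrm{rank}(D)=d$, then $M$ has a restriction isomorphic to $M(K_{d+1})$. In particular, if $M$ has no restriction isomorphic to $M(K_5)$, then $\mathrm{rank}(D)\le3$, and $M$ is the parallel connection of the restriction $M|X$ with one of: a point (at the empty set), a $3$-point line (at a point), $M(K_4)$ (at a $3$-point line), or the Fano plane $F_7$ (at a $3$-point line).
   Context: A copoint (hyperplane) is a flat of rank $\mathrm{rank}(M)-1$. A flat $X$ of $M$ is modular if for every line $L$ (rank-$2$ flat) with $\mathrm{rank}(X\vee L)=\mathrm{rank}(X)+1$, the intersection $X\cap L$ is nonempty. A submatroid here means a restriction of $M$ to a subset of its ground set. $M(K_n)$ is the cycle matroid of the complete graph $K_n$. The parallel connection of two matroids at a common flat $F$ (the empty set, a point or a line, with $M_1|F=M_2|F$ and $F$ modular in one of them) is the generalized parallel connection, whose flats are the sets whose intersections with the two ground sets are flats of the respective matroids. -}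

module Defs where

open import Data.Nat using (ℕ; zero; suc; _≤_; _<_; _∸_; _+_; _⊓_)
open import Data.Bool using (Bool; true; false; _∧_; _∨_; _xor_; if_then_else_)
open import Data.Fin as Fin using (Fin; zero; suc; _≟_)
open import Data.Fin.Subset using (Subset; _∈_; _∉_; _⊆_; _∪_; _∩_; ⁅_⁆; ∣_∣; ⊤; ⊥; ∁; Nonempty)
open import Data.Vec using (Vec; []; _∷_; replicate; zipWith; tabulate; lookup)
open import Data.Product using (Σ; _×_; _,_; proj₁; proj₂)
open import Data.Sum using (_⊎_)
open import Function using (_∘_)
open import Function.Definitions using (Injective)
open import Relation.Binary.PropositionalEquality using (_≡_; _≢_)
open import Relation.Nullary using (¬_)
open import Relation.Nullary.Decidable using (⌊_⌋)

record Matroid (n : ℕ) : Set where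
  field
    rk        : Subset n → ℕ
    rk-card   : ∀ S → rk S ≤ ∣ S ∣
    rk-mono   : ∀ S T → S ⊆ T → rk S ≤ rk T
    rk-submod : ∀ S T → rk (S ∪ T) + rk (S ∩ T) ≤ rk S + rk T

module _ {n : ℕ} (rk : Subset n → ℕ) where

  -- Flats of the restriction M|E (E a subset of the ground set).
  -- rank in M|E of a subset of E equals rank in M.
  FlatIn : Subset n → Subset n → Set
  FlatIn E F = F ⊆ E × (∀ x → x ∈ E → x ∉ F → rk F < rk (F ∪ ⁅ x ⁆))

  LineIn : Subset n → Subset n → Set
  LineIn E L = FlatIn E L × rk L ≡ 2

  -- Modular flats of M|E.  rank(X ∨ L) = rank of closure of X ∪ L = rk (X ∪ L).
  ModularIn : Subset n → Subset n → Set
  ModularIn E X = FlatIn E X ×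
    (∀ L → LineIn E L → rk (X ∪ L) ≡ suc (rk X) → Nonempty (X ∩ L))

  Copoint : Subset n → Set
  Copoint X = FlatIn ⊤ X × suc (rk X) ≡ rk ⊤

  Simple : Set
  Simple = (∀ x → rk ⁅ x ⁆ ≡ 1) × (∀ x y → x ≢ y → rk (⁅ x ⁆ ∪ ⁅ y ⁆) ≡ 2)

-- GF(2)-linear algebra: vectors in GF(2)^r are Vec Bool r, addition is xor.

zeroV : (r : ℕ) → Vec Bool r
zeroV r = replicate r false

sumV : ∀ {n r} → (Fin n → Vec Bool r) → Subset n → Vec Bool r
sumV {zero}  {r} vec []       = zeroV r
sumV {suc n} {r} vec (b ∷ U)  =
  if b then zipWith _xor_ (vec zero) (sumV (vec ∘ suc) U) else sumV (vec ∘ suc) U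

GF2Indep : ∀ {n r} → (Fin n → Vec Bool r) → Subset n → Set
GF2Indep {n} {r} vec T = ∀ U → U ⊆ T → Nonempty U → sumV vec U ≢ zeroV r

GF2Rank : ∀ {n r} → (Fin n → Vec Bool r) → Subset n → ℕ → Set
GF2Rank vec S k =
  Σ _ (λ T → T ⊆ S × GF2Indep vec T × ∣ T ∣ ≡ k) ×
  (∀ T → T ⊆ S → GF2Indep vec T → ∣ T ∣ ≤ k)

Binary : ∀ {n} → Matroid n → Set
Binary {n} M = Σ ℕ λ r → Σ (Fin n → Vec Bool r) λ vec →
  ∀ S → GF2Rank vec S (Matroid.rk M S)

anyFin : ∀ {k} → (Fin k → Bool) → Bool
anyFin {zero}  p = false
anyFin {suc k} p = p zero ∨ anyFin (p ∘ suc)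

image : ∀ {k n} → (Fin k → Fin n) → Subset k → Subset n
image f T = tabulate (λ x → anyFin (λ y → lookup T y ∧ ⌊ f y ≟ x ⌋))

-- M|Y is isomorphic to the matroid on Fin k whose rank relation is ρ
-- (ρ T j means: T has rank j).  f is a bijection Fin k ≅ Y.
RestrictionIso : ∀ {n k} → (Subset n → ℕ) → Subset n → (Subset k → ℕ → Set) → Set
RestrictionIso {n} {k} rk Y ρ = Σ (Fin k → Fin n) λ f →
  Injective _≡_ _≡_ f × image f ⊤ ≡ Y × (∀ T → ρ T (rk (image f T)))

module _ {v m : ℕ} (ends : Fin m → Fin v × Fin v) where

  data Conn (S : Subset m) (i : Fin v) : Fin v → Set where
    here : Conn S i i
    step : ∀ {j w} e → Conn S i j → e ∈ S →
           (ends e ≡ (j , w) ⊎ ends e ≡ (w , j)) → Conn S i w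

  -- cycle-matroid rank: r(S) = |V| - (number of components of (V,S));
  -- R is a set of representatives, one per component.
  GraphicRank : Subset m → ℕ → Set
  GraphicRank S k = Σ (Subset v) λ R →
    (∀ x → Σ (Fin v) λ r → r ∈ R × Conn S x r) ×
    (∀ r r′ → r ∈ R → r′ ∈ R → Conn S r r′ → r ≡ r′) ×
    k ≡ v ∸ ∣ R ∣

  CompleteEdges : Set
  CompleteEdges = (∀ e → proj₁ (ends e) Fin.< proj₂ (ends e)) ×
                  (∀ i j → i Fin.< j → Σ (Fin m) λ e → ends e ≡ (i , j)) ×
                  Injective _≡_ _≡_ ends

IsoMK : ∀ {n} → (Subset n → ℕ) → Subset n → ℕ → Set
IsoMK rk Y v = Σ ℕ λ m → Σ (Fin m → Fin v × Fin v) λ ends →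
  CompleteEdges ends × RestrictionIso rk Y (GraphicRank ends)

HasMK : ∀ {n} → (Subset n → ℕ) → ℕ → Set
HasMK {n} rk v = Σ (Subset n) λ Y → IsoMK rk Y v

pointRank : Subset 1 → ℕ → Set
pointRank T j = j ≡ ∣ T ∣

line3Rank : Subset 3 → ℕ → Set
line3Rank T j = j ≡ ∣ T ∣ ⊓ 2

-- Fano plane F_7 = PG(2,2): all nonzero vectors of GF(2)^3
fanoVec : Fin 7 → Vec Bool 3
fanoVec zero                                   = false ∷ false ∷ true ∷ []
fanoVec (suc zero)                             = false ∷ true ∷ false ∷ []
fanoVec (suc (suc zero))                       = false ∷ true ∷ true ∷ []
fanoVec (suc (suc (suc zero)))                 = true ∷ false ∷ false ∷ []
fanoVec (suc (suc (suc (suc zero))))           = true ∷ false ∷ true ∷ []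
fanoVec (suc (suc (suc (suc (suc zero)))))     = true ∷ true ∷ false ∷ []
fanoVec (suc (suc (suc (suc (suc (suc zero)))))) = true ∷ true ∷ true ∷ []

fanoRank : Subset 7 → ℕ → Set
fanoRank = GF2Rank fanoVec

-- M (ground set X ∪ Y) is the parallel connection of M|X and M|Y along
-- F = X ∩ Y: F is a common flat, modular in one of the two, and the flats
-- of M are exactly the sets Z with Z ∩ X a flat of M|X and Z ∩ Y a flat of M|Y.
-- (M|X and M|Y automatically agree on F, both being restrictions of M.)

IsParallelConnection : ∀ {n} → (Subset n → ℕ) → Subset n → Subset n → Set
IsParallelConnection rk X Y =
  X ∪ Y ≡ ⊤ ×
  FlatIn rk X (X ∩ Y) × FlatIn rk Y (X ∩ Y) ×
  (ModularIn rk X (X ∩ Y) ⊎ ModularIn rk Y (X ∩ Y)) ×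
  (∀ Z → (FlatIn rk ⊤ Z → FlatIn rk X (Z ∩ X) × FlatIn rk Y (Z ∩ Y)) ×
         (FlatIn rk X (Z ∩ X) × FlatIn rk Y (Z ∩ Y) → FlatIn rk ⊤ Z))

ThreePointLineIn : ∀ {n} → (Subset n → ℕ) → Subset n → Subset n → Set
ThreePointLineIn rk Y F = LineIn rk Y F × ∣ F ∣ ≡ 3

ParallelConnectionCases : ∀ {n} → (Subset n → ℕ) → Subset n → Set
ParallelConnectionCases {n} rk X = Σ (Subset n) λ Y →
  IsParallelConnection rk X Y ×
  ( (X ∩ Y ≡ ⊥ × RestrictionIso rk Y pointRank)
  ⊎ (∣ X ∩ Y ∣ ≡ 1 × RestrictionIso rk Y line3Rank)
  ⊎ (ThreePointLineIn rk Y (X ∩ Y) × IsoMK rk Y 4)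
  ⊎ (ThreePointLineIn rk Y (X ∩ Y) × RestrictionIso rk Y fanoRank))

module Submission where

open import Defs
open import Data.Nat as N using (ℕ; zero; suc; _≤_; _<_; z≤n; s≤s; _+_)
import Data.Nat.Properties as NP
open import Data.Bool as B using (Bool; true; false; _∧_; _∨_; _xor_)
import Data.Bool.Properties as BP
open import Data.Fin as F using (Fin; zero; suc)
import Data.Fin.Properties as FP
open import Data.Fin.Subset using (Subset; _∈_; _∉_; _⊆_; _∪_; _∩_; _─_; _-_; ⁅_⁆; ∣_∣; ⊤; ⊥; ∁; Nonempty)
import Data.Fin.Subset.Properties as SP
open import Data.Vec as V using (Vec; []; _∷_; zipWith; tabulate; lookup)
import Data.Vec.Properties as VP
open import Data.Product using (Σ; _×_; _,_; proj₁; proj₂; map₂) renaming (map to map×)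
open import Data.Sum using (_⊎_; inj₁; inj₂; [_,_]′; swap)
open import Data.Empty using () renaming (⊥ to Empty; ⊥-elim to absurd)
open import Function using (_∘_; id)
open import Function.Definitions using (Injective)
open import Data.List as L using (List; []; _∷_)
import Data.List.Membership.Propositional as LM
import Data.List.Membership.Propositional.Properties as LMP
open import Data.List.Relation.Unary.Any using (here; there)
open import Relation.Binary.PropositionalEquality
open import Relation.Nullary using (¬_; Dec; yes; no)
open import Relation.Nullary.Decidable using (⌊_⌋; _×-dec_; dec-true; isYes≗does; toWitness; ¬?; decidable-stable; _→-dec_)
open import Data.Unit using (tt)

-- M is represented by vectors vec x ∈ GF(2)^r.  The heart of the proof is the
-- consequence of modularity `sum-in-X`: for distinct points p, q outside X the
-- line through them meets X, necessarily in a point with vector vec p + vec q.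
--  * Take a basis b₀, …, b_{d-1} of D = E − X and vertex vectors W₀ = 0,
--    W_{i+1} = b_i.  The points with vectors W_i + W_j (i < j) exist and realise
--    K_{d+1}: by the graphic rank theorem for such configurations
--    (`GraphicRealisation`) their ranks are those of M(K_{d+1}).
--  * A parity argument shows that a sum of points of D lies in the span of X iff
--    there are evenly many.  With Y the closure of the basis of D and d ≤ 3, this
--    identifies X ∩ Y and proves that the flats of M are exactly the sets whose
--    traces on X and on Y are flats, i.e. M is the parallel connection along
--    X ∩ Y; coordinates with respect to b₀, …, b_{d-1} then identify M|Y for
--    d = 1, 2, 3.

-- GF(2)^r is Vec Bool r under pointwise xor.  A subset of Fin n is itself a
-- vector of GF(2)^n, so _⊕_ on subsets is symmetric difference.

infixl 6 _⊕_
_⊕_ : ∀ {r} → Vec Bool r → Vec Bool r → Vec Bool r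
_⊕_ = zipWith _xor_

⊕-comm : ∀ {r} (u v : Vec Bool r) → u ⊕ v ≡ v ⊕ u
⊕-comm = VP.zipWith-comm BP.xor-comm

⊕-assoc : ∀ {r} (u v w : Vec Bool r) → (u ⊕ v) ⊕ w ≡ u ⊕ (v ⊕ w)
⊕-assoc = VP.zipWith-assoc BP.xor-assoc

⊕-idˡ : ∀ {r} (u : Vec Bool r) → zeroV r ⊕ u ≡ u
⊕-idˡ = VP.zipWith-identityˡ BP.xor-identityˡ

⊕-idʳ : ∀ {r} (u : Vec Bool r) → u ⊕ zeroV r ≡ u
⊕-idʳ = VP.zipWith-identityʳ BP.xor-identityʳ

⊕-self : ∀ {r} (u : Vec Bool r) → u ⊕ u ≡ zeroV r
⊕-self []      = refl
⊕-self (a ∷ u) = cong₂ _∷_ (BP.xor-same a) (⊕-self u)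

⊕-cancel : ∀ {r} (u v : Vec Bool r) → u ⊕ v ≡ zeroV r → u ≡ v
⊕-cancel u v uv≡0 = begin
  u               ≡⟨ sym (⊕-idʳ u) ⟩
  u ⊕ zeroV _     ≡⟨ cong (u ⊕_) (sym (⊕-self v)) ⟩
  u ⊕ (v ⊕ v)     ≡⟨ sym (⊕-assoc u v v) ⟩
  (u ⊕ v) ⊕ v     ≡⟨ cong (_⊕ v) uv≡0 ⟩
  zeroV _ ⊕ v     ≡⟨ ⊕-idˡ v ⟩
  v               ∎
  where open ≡-Reasoning

⊕-solve : ∀ {r} {u a s : Vec Bool r} → u ≡ a ⊕ s → a ≡ u ⊕ s
⊕-solve {a = a} {s} refl = begin
  a                   ≡⟨ sym (⊕-idʳ a) ⟩
  a ⊕ zeroV _         ≡⟨ cong (a ⊕_) (sym (⊕-self s)) ⟩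
  a ⊕ (s ⊕ s)         ≡⟨ sym (⊕-assoc a s s) ⟩
  (a ⊕ s) ⊕ s         ∎
  where open ≡-Reasoning

⊕-telescope : ∀ {r} (a b c : Vec Bool r) → (a ⊕ b) ⊕ (b ⊕ c) ≡ a ⊕ c
⊕-telescope a b c = begin
  (a ⊕ b) ⊕ (b ⊕ c)   ≡⟨ ⊕-assoc a b (b ⊕ c) ⟩
  a ⊕ (b ⊕ (b ⊕ c))   ≡⟨ cong (a ⊕_) (sym (⊕-assoc b b c)) ⟩
  a ⊕ ((b ⊕ b) ⊕ c)   ≡⟨ cong (λ z → a ⊕ (z ⊕ c)) (⊕-self b) ⟩
  a ⊕ (zeroV _ ⊕ c)   ≡⟨ cong (a ⊕_) (⊕-idˡ c) ⟩
  a ⊕ c               ∎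
  where open ≡-Reasoning

⊕-interchange : ∀ {r} (a b c d : Vec Bool r) → (a ⊕ b) ⊕ (c ⊕ d) ≡ (a ⊕ c) ⊕ (b ⊕ d)
⊕-interchange a b c d = begin
  (a ⊕ b) ⊕ (c ⊕ d)   ≡⟨ ⊕-assoc a b (c ⊕ d) ⟩
  a ⊕ (b ⊕ (c ⊕ d))   ≡⟨ cong (a ⊕_) (sym (⊕-assoc b c d)) ⟩
  a ⊕ ((b ⊕ c) ⊕ d)   ≡⟨ cong (λ z → a ⊕ (z ⊕ d)) (⊕-comm b c) ⟩
  a ⊕ ((c ⊕ b) ⊕ d)   ≡⟨ cong (a ⊕_) (⊕-assoc c b d) ⟩
  a ⊕ (c ⊕ (b ⊕ d))   ≡⟨ sym (⊕-assoc a c (b ⊕ d)) ⟩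
  (a ⊕ c) ⊕ (b ⊕ d)   ∎
  where open ≡-Reasoning

vec-ext : ∀ {a} {A : Set a} {n} {xs ys : Vec A n} → (∀ i → lookup xs i ≡ lookup ys i) → xs ≡ ys
vec-ext {xs = xs} {ys} p =
  trans (sym (VP.tabulate∘lookup xs)) (trans (VP.tabulate-cong p) (VP.tabulate∘lookup ys))

∈⇒true : ∀ {n} {x : Fin n} {p} → x ∈ p → lookup p x ≡ true
∈⇒true = VP.[]=⇒lookup

true⇒∈ : ∀ {n} {x : Fin n} {p} → lookup p x ≡ true → x ∈ p
true⇒∈ {x = x} {p} = VP.lookup⇒[]= x p

∉⇒false : ∀ {n} {x : Fin n} {p} → x ∉ p → lookup p x ≡ false
∉⇒false x∉p = BP.¬-not (x∉p ∘ true⇒∈)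

lookup-⊕ : ∀ {n} (p q : Vec Bool n) i → lookup (p ⊕ q) i ≡ lookup p i xor lookup q i
lookup-⊕ p q i = VP.lookup-zipWith _xor_ i p q

lookup-zeroV : ∀ {n} (i : Fin n) → lookup (zeroV n) i ≡ false
lookup-zeroV i = VP.lookup-replicate i false

lookup-⁅⁆ : ∀ {n} (x i : Fin n) → lookup ⁅ x ⁆ i ≡ ⌊ x F.≟ i ⌋
lookup-⁅⁆ x i with x F.≟ i
... | yes refl = ∈⇒true (SP.x∈⁅x⁆ x)
... | no x≢i   = ∉⇒false (SP.x≢y⇒x∉⁅y⁆ (x≢i ∘ sym))

∉⊥ : ∀ {n} {x : Fin n} → x ∉ ⊥
∉⊥ {x = x} x∈⊥ with trans (sym (∈⇒true x∈⊥)) (lookup-zeroV x)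
... | ()

∈⊤ : ∀ {n} {x : Fin n} → x ∈ ⊤
∈⊤ = SP.⊆⊤ (SP.x∈⁅x⁆ _)

⁅⁆⊆ : ∀ {n} {x : Fin n} {p} → x ∈ p → ⁅ x ⁆ ⊆ p
⁅⁆⊆ {x = x} x∈p y∈⁅x⁆ = subst (_∈ _) (sym (SP.x∈⁅y⁆⇒x≡y x y∈⁅x⁆)) x∈p

⊕-⊆ : ∀ {n} {p q G : Subset n} → p ⊆ G → q ⊆ G → p ⊕ q ⊆ G
⊕-⊆ {p = p} {q} p⊆G q⊆G {i} i∈p⊕q
  with lookup p i in ep | lookup q i in eq | trans (sym (lookup-⊕ p q i)) (∈⇒true i∈p⊕q)
... | true | _    | _ = p⊆G (true⇒∈ ep)
... | false | true | _ = q⊆G (true⇒∈ eq)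

zeroV-⊆ : ∀ {n} {G : Subset n} → zeroV n ⊆ G
zeroV-⊆ x∈⊥ = absurd (∉⊥ x∈⊥)

∣p∣≡1+∣p-x∣ : ∀ {n} (p : Subset n) (x : Fin n) → x ∈ p → ∣ p ∣ ≡ suc ∣ p - x ∣
∣p∣≡1+∣p-x∣ (true ∷ p)  zero    _         = cong (suc ∘ ∣_∣) (sym (SP.p─⊥≡p p))
∣p∣≡1+∣p-x∣ (true ∷ p)  (suc x) (V.there m) = cong suc (∣p∣≡1+∣p-x∣ p x m)
∣p∣≡1+∣p-x∣ (false ∷ p) (suc x) (V.there m) = ∣p∣≡1+∣p-x∣ p x m

∣p-x∣≡ : ∀ {n k} (p : Subset n) x → x ∈ p → ∣ p ∣ ≡ suc k → ∣ p - x ∣ ≡ k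
∣p-x∣≡ p x x∈p ∣p∣≡ = NP.suc-injective (trans (sym (∣p∣≡1+∣p-x∣ p x x∈p)) ∣p∣≡)

∣p∪⁅x⁆∣ : ∀ {n} (p : Subset n) x → x ∉ p → ∣ p ∪ ⁅ x ⁆ ∣ ≡ suc ∣ p ∣
∣p∪⁅x⁆∣ (false ∷ p) zero    _   = cong (suc ∘ ∣_∣) (SP.∪-identityʳ p)
∣p∪⁅x⁆∣ (true ∷ p)  zero    x∉p = absurd (x∉p V.here)
∣p∪⁅x⁆∣ (false ∷ p) (suc x) x∉p = ∣p∪⁅x⁆∣ p x (x∉p ∘ V.there)
∣p∪⁅x⁆∣ (true ∷ p)  (suc x) x∉p = cong suc (∣p∪⁅x⁆∣ p x (x∉p ∘ V.there))

card>0⇒nonempty : ∀ {n} (J : Subset n) → 0 < ∣ J ∣ → Nonempty J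
card>0⇒nonempty (true ∷ J)  _  = zero , V.here
card>0⇒nonempty (false ∷ J) lt with card>0⇒nonempty J lt
... | x , x∈J = suc x , V.there x∈J

card≡0⇒⊥ : ∀ {k} (U : Subset k) → ∣ U ∣ ≡ 0 → U ≡ ⊥
card≡0⇒⊥ []          _  = refl
card≡0⇒⊥ (false ∷ U) e  = cong (false ∷_) (card≡0⇒⊥ U e)

∈─⇒∉ : ∀ {n} (p q : Subset n) {x} → x ∈ p ─ q → x ∉ q
∈─⇒∉ (true ∷ p) (false ∷ q) V.here      ()
∈─⇒∉ (_ ∷ p)    (_ ∷ q)     (V.there m) (V.there m') = ∈─⇒∉ p q m m'

∈-─ : ∀ {k} {U : Subset k} {x y} → y ∈ U - x → y ∈ U × x ≢ y
∈-─ {U = U} {x} y∈U-x =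
  SP.p─q⊆p U ⁅ x ⁆ y∈U-x , λ { refl → ∈─⇒∉ U ⁅ x ⁆ y∈U-x (SP.x∈⁅x⁆ x) }

infixr 7 _·_
_·_ : ∀ {r} → Bool → Vec Bool r → Vec Bool r
true  · v = v
false · v = zeroV _

·-distrib-xor : ∀ {r} a b (v : Vec Bool r) → (a xor b) · v ≡ a · v ⊕ b · v
·-distrib-xor true  true  v = sym (⊕-self v)
·-distrib-xor true  false v = sym (⊕-idʳ v)
·-distrib-xor false b     v = sym (⊕-idˡ (b · v))

·-distrib-⊕ : ∀ {r} b (u v : Vec Bool r) → b · (u ⊕ v) ≡ b · u ⊕ b · v
·-distrib-⊕ true  u v = refl
·-distrib-⊕ false u v = sym (⊕-idˡ (zeroV _))

sumV-∷ : ∀ {n r} (w : Fin (suc n) → Vec Bool r) b U → sumV w (b ∷ U) ≡ b · w zero ⊕ sumV (w ∘ suc) U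
sumV-∷ w true  U = refl
sumV-∷ w false U = sym (⊕-idˡ _)

sumV-⊥ : ∀ {n r} (w : Fin n → Vec Bool r) → sumV w ⊥ ≡ zeroV r
sumV-⊥ {zero}  w = refl
sumV-⊥ {suc n} w = sumV-⊥ (w ∘ suc)

sumV-⁅⁆ : ∀ {n r} (w : Fin n → Vec Bool r) (x : Fin n) → sumV w ⁅ x ⁆ ≡ w x
sumV-⁅⁆ w zero    = trans (cong (w zero ⊕_) (sumV-⊥ (w ∘ suc))) (⊕-idʳ _)
sumV-⁅⁆ w (suc x) = sumV-⁅⁆ (w ∘ suc) x

sumV-lin : ∀ {n r} (w : Fin n → Vec Bool r) (U V : Subset n) → sumV w (U ⊕ V) ≡ sumV w U ⊕ sumV w V
sumV-lin w []      []      = sym (⊕-idˡ _)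
sumV-lin w (a ∷ U) (b ∷ V) = begin
  sumV w ((a xor b) ∷ (U ⊕ V))                          ≡⟨ sumV-∷ w (a xor b) (U ⊕ V) ⟩
  (a xor b) · w zero ⊕ sumV (w ∘ suc) (U ⊕ V)            ≡⟨ cong₂ _⊕_ (·-distrib-xor a b (w zero)) (sumV-lin (w ∘ suc) U V) ⟩
  (a · w zero ⊕ b · w zero) ⊕ (sumV (w ∘ suc) U ⊕ sumV (w ∘ suc) V)
                                                        ≡⟨ ⊕-interchange _ _ _ _ ⟩
  (a · w zero ⊕ sumV (w ∘ suc) U) ⊕ (b · w zero ⊕ sumV (w ∘ suc) V)
                                                        ≡⟨ sym (cong₂ _⊕_ (sumV-∷ w a U) (sumV-∷ w b V)) ⟩
  sumV w (a ∷ U) ⊕ sumV w (b ∷ V)                       ∎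
  where open ≡-Reasoning

sumV-fam : ∀ {n r} (f g : Fin n → Vec Bool r) (U : Subset n) → sumV (λ i → f i ⊕ g i) U ≡ sumV f U ⊕ sumV g U
sumV-fam f g []      = sym (⊕-idˡ _)
sumV-fam f g (b ∷ U) = begin
  sumV (λ i → f i ⊕ g i) (b ∷ U)                        ≡⟨ sumV-∷ (λ i → f i ⊕ g i) b U ⟩
  b · (f zero ⊕ g zero) ⊕ sumV (λ i → f (suc i) ⊕ g (suc i)) U
                                                        ≡⟨ cong₂ _⊕_ (·-distrib-⊕ b (f zero) (g zero)) (sumV-fam (f ∘ suc) (g ∘ suc) U) ⟩
  (b · f zero ⊕ b · g zero) ⊕ (sumV (f ∘ suc) U ⊕ sumV (g ∘ suc) U)
                                                        ≡⟨ ⊕-interchange _ _ _ _ ⟩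
  (b · f zero ⊕ sumV (f ∘ suc) U) ⊕ (b · g zero ⊕ sumV (g ∘ suc) U)
                                                        ≡⟨ sym (cong₂ _⊕_ (sumV-∷ f b U) (sumV-∷ g b U)) ⟩
  sumV f (b ∷ U) ⊕ sumV g (b ∷ U)                       ∎
  where open ≡-Reasoning

sumV-cong : ∀ {n r} {f g : Fin n → Vec Bool r} (U : Subset n) → (∀ i → i ∈ U → f i ≡ g i) → sumV f U ≡ sumV g U
sumV-cong []          f≗g = refl
sumV-cong (false ∷ U) f≗g = sumV-cong U (λ i m → f≗g (suc i) (V.there m))
sumV-cong (true ∷ U)  f≗g = cong₂ _⊕_ (f≗g zero V.here) (sumV-cong U (λ i m → f≗g (suc i) (V.there m)))

sumV-comp : ∀ {a m r} (g : Fin m → Vec Bool r) (c : Fin a → Vec Bool m) (U : Subset a) →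
            sumV g (sumV c U) ≡ sumV (λ j → sumV g (c j)) U
sumV-comp g c []          = sumV-⊥ g
sumV-comp g c (false ∷ U) = sumV-comp g (c ∘ suc) U
sumV-comp g c (true ∷ U)  = trans (sumV-lin g (c zero) _) (cong (sumV g (c zero) ⊕_) (sumV-comp g (c ∘ suc) U))

sumV-⊆ : ∀ {a m} (c : Fin a → Vec Bool m) (U : Subset a) {G : Subset m} → (∀ j → j ∈ U → c j ⊆ G) → sumV c U ⊆ G
sumV-⊆ c []          h = zeroV-⊆
sumV-⊆ c (false ∷ U) h = sumV-⊆ (c ∘ suc) U (λ j m → h (suc j) (V.there m))
sumV-⊆ c (true ∷ U)  h = ⊕-⊆ (h zero V.here) (sumV-⊆ (c ∘ suc) U (λ j m → h (suc j) (V.there m)))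

-- parity h U = Σ_{i ∈ U} h i in GF(2); it describes sums of vectors with a
-- common head coordinate or a common direction.
parity : ∀ {n} → (Fin n → Bool) → Subset n → Bool
parity h []          = false
parity h (false ∷ U) = parity (h ∘ suc) U
parity h (true ∷ U)  = h zero xor parity (h ∘ suc) U

sumV-head∷tail : ∀ {n r} (h : Fin n → Bool) (t : Fin n → Vec Bool r) (U : Subset n) →
                 sumV (λ j → h j ∷ t j) U ≡ parity h U ∷ sumV t U
sumV-head∷tail h t []          = refl
sumV-head∷tail h t (false ∷ U) = sumV-head∷tail (h ∘ suc) (t ∘ suc) U
sumV-head∷tail h t (true ∷ U)  = cong (zipWith _xor_ (h zero ∷ t zero)) (sumV-head∷tail (h ∘ suc) (t ∘ suc) U)

sumV-scalar : ∀ {n r} (h : Fin n → Bool) (v : Vec Bool r) (U : Subset n) → sumV (λ j → h j · v) U ≡ parity h U · v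
sumV-scalar h v []          = refl
sumV-scalar h v (false ∷ U) = sumV-scalar (h ∘ suc) v U
sumV-scalar h v (true ∷ U)  = trans (cong (h zero · v ⊕_) (sumV-scalar (h ∘ suc) v U)) (sym (·-distrib-xor (h zero) _ v))

parity-false : ∀ {n} (h : Fin n → Bool) (U : Subset n) → (∀ j → j ∈ U → h j ≡ false) → parity h U ≡ false
parity-false h []          _ = refl
parity-false h (false ∷ U) k = parity-false (h ∘ suc) U (λ j m → k (suc j) (V.there m))
parity-false h (true ∷ U)  k rewrite k zero V.here = parity-false (h ∘ suc) U (λ j m → k (suc j) (V.there m))

true≢false : true ≢ false
true≢false ()

false⇒∉ : ∀ {n} {x : Fin n} {p} → lookup p x ≡ false → x ∉ p
false⇒∉ e x∈p = true≢false (trans (sym (∈⇒true x∈p)) e)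

∈⊕∉⇒∈ : ∀ {n} {x : Fin n} {p q} → x ∈ p → x ∉ q → x ∈ p ⊕ q
∈⊕∉⇒∈ {x = x} {p} {q} x∈p x∉q =
  true⇒∈ (trans (lookup-⊕ p q x) (cong₂ _xor_ (∈⇒true x∈p) (∉⇒false x∉q)))

lookup-· : ∀ {r} b (v : Vec Bool r) x → lookup (b · v) x ≡ b ∧ lookup v x
lookup-· true  v x = refl
lookup-· false v x = lookup-zeroV x

·-⊆ : ∀ {n} b {v G : Subset n} → v ⊆ G → b · v ⊆ G
·-⊆ true  v⊆G = v⊆G
·-⊆ false v⊆G = zeroV-⊆

sumV-· : ∀ {n r} (w : Fin n → Vec Bool r) b S → sumV w (b · S) ≡ b · sumV w S
sumV-· w true  S = refl
sumV-· w false S = sumV-⊥ w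

-- The proof is Gaussian elimination on a coordinate
-- g ∈ G: either no vector uses g, or some c j₀ does, and adding c j₀ to every
-- vector using g clears that coordinate.

module Elimination {a k : ℕ} (c : Fin a → Vec Bool k) (j₀ : Fin a) (g : Fin k) (g∈cj₀ : g ∈ c j₀) where

  cleared : Fin a → Vec Bool k
  cleared j = c j ⊕ lookup (c j) g · c j₀

  lookup-cleared : ∀ j → lookup (cleared j) g ≡ false
  lookup-cleared j = begin
    lookup (cleared j) g             ≡⟨ lookup-⊕ (c j) _ g ⟩
    b xor lookup (b · c j₀) g        ≡⟨ cong (b xor_) (lookup-· b (c j₀) g) ⟩
    b xor (b ∧ lookup (c j₀) g)      ≡⟨ cong (λ z → b xor (b ∧ z)) (∈⇒true g∈cj₀) ⟩
    b xor (b ∧ true)                 ≡⟨ cong (b xor_) (BP.∧-identityʳ b) ⟩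
    b xor b                          ≡⟨ BP.xor-same b ⟩
    false                            ∎
    where
    open ≡-Reasoning
    b = lookup (c j) g

  cleared-⊆ : ∀ {G} → c j₀ ⊆ G → ∀ j → c j ⊆ G → cleared j ⊆ G - g
  cleared-⊆ cj₀⊆G j cj⊆G y∈ =
    SP.x∈p∧x≢y⇒x∈p-y (⊕-⊆ cj⊆G (·-⊆ (lookup (c j) g) cj₀⊆G) y∈)
                     (λ { refl → false⇒∉ (lookup-cleared j) y∈ })

  lift : ∀ {J U} → j₀ ∈ J → U ⊆ J - j₀ → Nonempty U → sumV cleared U ≡ zeroV k →
         Σ (Subset a) λ U′ → U′ ⊆ J × Nonempty U′ × sumV c U′ ≡ zeroV k
  lift {J} {U} j₀∈J U⊆ (x , x∈U) Σ≡0 = U′ , U′⊆J , (x , x∈U′) , ΣU′≡0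
    where
    p : Bool
    p = parity (λ j → lookup (c j) g) U
    U′ : Subset a
    U′ = U ⊕ p · ⁅ j₀ ⁆
    U′⊆J : U′ ⊆ J
    U′⊆J = ⊕-⊆ (SP.p─q⊆p J ⁅ j₀ ⁆ ∘ U⊆) (·-⊆ p (⁅⁆⊆ j₀∈J))
    x∈U′ : x ∈ U′
    x∈U′ = ∈⊕∉⇒∈ x∈U λ x∈ → proj₂ (∈-─ (U⊆ x∈U)) (sym (SP.x∈⁅y⁆⇒x≡y j₀ (·-⊆ p SP.⊆-refl x∈)))
    ΣU′≡0 : sumV c U′ ≡ zeroV k
    ΣU′≡0 = begin
      sumV c (U ⊕ p · ⁅ j₀ ⁆)                     ≡⟨ sumV-lin c U _ ⟩
      sumV c U ⊕ sumV c (p · ⁅ j₀ ⁆)              ≡⟨ cong (sumV c U ⊕_) (trans (sumV-· c p ⁅ j₀ ⁆) (cong (p ·_) (sumV-⁅⁆ c j₀))) ⟩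
      sumV c U ⊕ p · c j₀                         ≡⟨ cong (sumV c U ⊕_) (sym (sumV-scalar (λ j → lookup (c j) g) (c j₀) U)) ⟩
      sumV c U ⊕ sumV (λ j → lookup (c j) g · c j₀) U ≡⟨ sym (sumV-fam c _ U) ⟩
      sumV cleared U                              ≡⟨ Σ≡0 ⟩
      zeroV k                                     ∎
      where open ≡-Reasoning

dependent : ∀ s {a k} (c : Fin a → Vec Bool k) (J : Subset a) (G : Subset k) → ∣ G ∣ ≡ s →
            (∀ j → j ∈ J → c j ⊆ G) → ∣ G ∣ < ∣ J ∣ →
            Σ (Subset a) λ U → U ⊆ J × Nonempty U × sumV c U ≡ zeroV k
dependent zero c J G ∣G∣≡0 supp lt with card>0⇒nonempty J (NP.≤-<-trans z≤n lt)
... | j , j∈J = ⁅ j ⁆ , ⁅⁆⊆ j∈J , (j , SP.x∈⁅x⁆ j) , trans (sumV-⁅⁆ c j) cj≡0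
  where
  cj≡0 : c j ≡ zeroV _
  cj≡0 = SP.⊆-antisym (subst (c j ⊆_) (card≡0⇒⊥ G ∣G∣≡0) (supp j j∈J)) zeroV-⊆
dependent (suc s) {a} {k} c J G ∣G∣≡1+s supp lt = eliminate (card>0⇒nonempty G (subst (0 <_) (sym ∣G∣≡1+s) (s≤s z≤n)))
  where
  Result : Set
  Result = Σ (Subset a) λ U → U ⊆ J × Nonempty U × sumV c U ≡ zeroV k
  eliminate : Nonempty G → Result
  eliminate (g , g∈G) = by-use (FP.any? (λ j → (j SP.∈? J) ×-dec (g SP.∈? c j)))
    where
    ∣G-g∣≡s : ∣ G - g ∣ ≡ s
    ∣G-g∣≡s = ∣p-x∣≡ G g g∈G ∣G∣≡1+s
    by-use : Dec (Σ (Fin a) λ j → j ∈ J × g ∈ c j) → Result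
    by-use (no none) = dependent s c J (G - g) ∣G-g∣≡s supp′ (NP.<-trans (subst (_< ∣ G ∣) (sym ∣G-g∣≡s) (NP.≤-reflexive (sym ∣G∣≡1+s))) lt)
      where
      supp′ : ∀ j → j ∈ J → c j ⊆ G - g
      supp′ j j∈J y∈ = SP.x∈p∧x≢y⇒x∈p-y (supp j j∈J y∈) λ { refl → none (j , j∈J , y∈) }
    by-use (yes (j₀ , j₀∈J , g∈cj₀)) = lift j₀∈J (proj₁ (proj₂ IH)) (proj₁ (proj₂ (proj₂ IH))) (proj₂ (proj₂ (proj₂ IH)))
      where
      open Elimination c j₀ g g∈cj₀
      lt′ : ∣ G - g ∣ < ∣ J - j₀ ∣
      lt′ = subst (_< ∣ J - j₀ ∣) (sym ∣G-g∣≡s) (NP.≤-pred (subst₂ _<_ ∣G∣≡1+s (∣p∣≡1+∣p-x∣ J j₀ j₀∈J) lt))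
      IH : Σ (Subset a) λ U → U ⊆ J - j₀ × Nonempty U × sumV cleared U ≡ zeroV k
      IH = dependent s cleared (J - j₀) (G - g) ∣G-g∣≡s
             (λ j j∈ → cleared-⊆ (supp j₀ j₀∈J) j (supp j (proj₁ (∈-─ j∈)))) lt′

independent-≤-spanning : ∀ {a m r} (u : Fin a → Vec Bool r) (J : Subset a) → GF2Indep u J →
     (g : Fin m → Vec Bool r) (G : Subset m) (c : Fin a → Vec Bool m) →
     (∀ j → j ∈ J → c j ⊆ G × sumV g (c j) ≡ u j) → ∣ J ∣ ≤ ∣ G ∣
independent-≤-spanning {r = r} u J indep g G c coeffs with ∣ J ∣ N.≤? ∣ G ∣
... | yes le = le
... | no nle = contradiction (dependent ∣ G ∣ c J G refl (λ j j∈J → proj₁ (coeffs j j∈J)) (NP.≰⇒> nle))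
  where
  -- a dependency among the coefficient vectors is one among the u j
  contradiction : (Σ (Subset _) λ U → U ⊆ J × Nonempty U × sumV c U ≡ zeroV _) → ∣ J ∣ ≤ ∣ G ∣
  contradiction (U , U⊆J , U≠∅ , ΣcU≡0) = absurd (indep U U⊆J U≠∅ ΣuU≡0)
    where
    ΣuU≡0 : sumV u U ≡ zeroV r
    ΣuU≡0 = begin
      sumV u U                         ≡⟨ sumV-cong U (λ i i∈U → sym (proj₂ (coeffs i (U⊆J i∈U)))) ⟩
      sumV (λ j → sumV g (c j)) U      ≡⟨ sym (sumV-comp g c U) ⟩
      sumV g (sumV c U)                ≡⟨ cong (sumV g) ΣcU≡0 ⟩
      sumV g (zeroV _)                 ≡⟨ sumV-⊥ g ⟩
      zeroV r                          ∎
      where open ≡-Reasoning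

∈∪⁅⁆ : ∀ {n} {B : Subset n} {x i} → i ∈ B ∪ ⁅ x ⁆ → i ∈ B ⊎ i ≡ x
∈∪⁅⁆ {B = B} {x} m with SP.x∈p∪q⁻ B ⁅ x ⁆ m
... | inj₁ i∈B = inj₁ i∈B
... | inj₂ i∈x = inj₂ (SP.x∈⁅y⁆⇒x≡y x i∈x)

∪⁅⁆-⊆ : ∀ {n} {B C : Subset n} {x} → B ⊆ C → x ∈ C → B ∪ ⁅ x ⁆ ⊆ C
∪⁅⁆-⊆ B⊆C x∈C m with ∈∪⁅⁆ m
... | inj₁ i∈B  = B⊆C i∈B
... | inj₂ refl = x∈C

split-off : ∀ {n} (U : Subset n) x → x ∈ U → (U - x) ⊕ ⁅ x ⁆ ≡ U
split-off (true ∷ U) zero    _         = cong (true ∷_) (trans (⊕-idʳ _) (SP.p─⊥≡p U))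
split-off (b ∷ U)    (suc x) (V.there m) = cong₂ _∷_ (BP.xor-identityʳ b) (split-off U x m)

sumV-split-off : ∀ {n r} (w : Fin n → Vec Bool r) (U : Subset n) x → x ∈ U → sumV w U ≡ sumV w (U - x) ⊕ w x
sumV-split-off w U x x∈U = begin
  sumV w U                         ≡⟨ cong (sumV w) (sym (split-off U x x∈U)) ⟩
  sumV w ((U - x) ⊕ ⁅ x ⁆)          ≡⟨ sumV-lin w (U - x) ⁅ x ⁆ ⟩
  sumV w (U - x) ⊕ sumV w ⁅ x ⁆     ≡⟨ cong (sumV w (U - x) ⊕_) (sumV-⁅⁆ w x) ⟩
  sumV w (U - x) ⊕ w x             ∎
  where open ≡-Reasoning

InSpan : ∀ {n r} → (Fin n → Vec Bool r) → Subset n → Vec Bool r → Set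
InSpan w A v = Σ _ λ U → U ⊆ A × sumV w U ≡ v

coeffs : ∀ {n m r} (w : Fin n → Vec Bool r) {A : Subset n} {g : Fin m → Vec Bool r} {B : Subset m} →
         (∀ x → x ∈ A → InSpan g B (w x)) → Fin n → Subset m
coeffs w {A} h x with x SP.∈? A
... | yes x∈A = proj₁ (h x x∈A)
... | no _    = ⊥

coeffs-ok : ∀ {n m r} (w : Fin n → Vec Bool r) {A : Subset n} {g : Fin m → Vec Bool r} {B : Subset m} →
            (h : ∀ x → x ∈ A → InSpan g B (w x)) → ∀ x → x ∈ A → coeffs w h x ⊆ B × sumV g (coeffs w h x) ≡ w x
coeffs-ok w {A} h x x∈A with x SP.∈? A
... | yes x∈A′ = proj₂ (h x x∈A′)
... | no x∉A   = absurd (x∉A x∈A)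

module Span {n r : ℕ} (w : Fin n → Vec Bool r) where

  span-⊕ : ∀ {A v₁ v₂} → InSpan w A v₁ → InSpan w A v₂ → InSpan w A (v₁ ⊕ v₂)
  span-⊕ (U₁ , U₁⊆A , e₁) (U₂ , U₂⊆A , e₂) = U₁ ⊕ U₂ , ⊕-⊆ U₁⊆A U₂⊆A , trans (sumV-lin w U₁ U₂) (cong₂ _⊕_ e₁ e₂)

  span-mem : ∀ {A x} → x ∈ A → InSpan w A (w x)
  span-mem {x = x} x∈A = ⁅ x ⁆ , ⁅⁆⊆ x∈A , sumV-⁅⁆ w x

  span-zero : ∀ {A} → InSpan w A (zeroV r)
  span-zero = ⊥ , zeroV-⊆ , sumV-⊥ w

  span-mono : ∀ {A B v} → A ⊆ B → InSpan w A v → InSpan w B v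
  span-mono A⊆B (U , U⊆A , e) = U , A⊆B ∘ U⊆A , e

  span-trans : ∀ {m} {A : Subset n} {g : Fin m → Vec Bool r} {B : Subset m} {v} →
               (∀ x → x ∈ A → InSpan g B (w x)) → InSpan w A v → InSpan g B v
  span-trans {g = g} {B} h (U , U⊆A , e) =
    sumV (coeffs w h) U ,
    sumV-⊆ (coeffs w h) U (λ j j∈U → proj₁ (coeffs-ok w h j (U⊆A j∈U))) ,
    trans (sumV-comp g (coeffs w h) U) (trans (sumV-cong U (λ i i∈U → proj₂ (coeffs-ok w h i (U⊆A i∈U)))) e)

  inSpan? : ∀ A v → Dec (InSpan w A v)
  inSpan? A v = SP.anySubset? (λ U → (U SP.⊆? A) ×-dec VP.≡-dec B._≟_ (sumV w U) v)

  indep-∪ : ∀ {B x} → GF2Indep w B → ¬ InSpan w B (w x) → GF2Indep w (B ∪ ⁅ x ⁆)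
  indep-∪ {B} {x} indep x∉span U U⊆ U≠∅ ΣU≡0 with x SP.∈? U
  ... | no x∉U = indep U U⊆B U≠∅ ΣU≡0
    where
    U⊆B : U ⊆ B
    U⊆B i∈U with ∈∪⁅⁆ (U⊆ i∈U)
    ... | inj₁ i∈B  = i∈B
    ... | inj₂ refl = absurd (x∉U i∈U)
  ... | yes x∈U = x∉span (U - x , U-x⊆B , ⊕-cancel _ _ (trans (sym (sumV-split-off w U x x∈U)) ΣU≡0))
    where
    U-x⊆B : U - x ⊆ B
    U-x⊆B i∈ with ∈∪⁅⁆ (U⊆ (proj₁ (∈-─ i∈)))
    ... | inj₁ i∈B  = i∈B
    ... | inj₂ refl = absurd (proj₂ (∈-─ i∈) refl)

  rank-≤ : ∀ {S k m} {g : Fin m → Vec Bool r} {G : Subset m} → GF2Rank w S k →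
           (∀ x → x ∈ S → InSpan g G (w x)) → k ≤ ∣ G ∣
  rank-≤ {g = g} {G} ((T , T⊆S , indep , ∣T∣≡k) , _) h =
    subst (_≤ ∣ G ∣) ∣T∣≡k (independent-≤-spanning w T indep g G (coeffs w h) (λ j j∈T → coeffs-ok w h j (T⊆S j∈T)))

  record Basis (S : Subset n) (k : ℕ) : Set where
    field
      base   : Subset n
      ⊆S     : base ⊆ S
      indep  : GF2Indep w base
      card   : ∣ base ∣ ≡ k
      spans  : ∀ x → x ∈ S → InSpan w base (w x)

  -- A witness of GF2Rank w S k is a basis: by maximality every further vector of S is in its span.
  basis : ∀ {S k} → GF2Rank w S k → Basis S k
  basis {S} {k} ((T , T⊆S , indep , ∣T∣≡k) , maximal) = record
    { base = T ; ⊆S = T⊆S ; indep = indep ; card = ∣T∣≡k ; spans = spans }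
    where
    spans : ∀ x → x ∈ S → InSpan w T (w x)
    spans x x∈S with inSpan? T (w x)
    ... | yes sp = sp
    ... | no nsp = absurd (NP.<-irrefl refl (subst (_≤ k) (trans (∣p∪⁅x⁆∣ T x x∉T) (cong suc ∣T∣≡k)) bigger))
      where
      x∉T : x ∉ T
      x∉T x∈T = nsp (span-mem x∈T)
      bigger : ∣ T ∪ ⁅ x ⁆ ∣ ≤ k
      bigger = maximal (T ∪ ⁅ x ⁆) (∪⁅⁆-⊆ T⊆S x∈S) (indep-∪ indep nsp)

  rank-≡ : ∀ {S k a} → GF2Rank w S k → (u : Fin a → Vec Bool r) (J : Subset a) → GF2Indep u J →
           (∀ j → j ∈ J → InSpan w S (u j)) → (∀ x → x ∈ S → InSpan u J (w x)) → k ≡ ∣ J ∣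
  rank-≡ {k = k} R u J indepJ J⊆span S⊆span = NP.≤-antisym (rank-≤ R S⊆span) ∣J∣≤k
    where
    open Basis (basis R)
    J⊆spanB : ∀ j → j ∈ J → InSpan w base (u j)
    J⊆spanB j j∈J = span-trans spans (J⊆span j j∈J)
    ∣J∣≤k : ∣ J ∣ ≤ k
    ∣J∣≤k = subst (∣ J ∣ ≤_) card
      (independent-≤-spanning u J indepJ w base (coeffs u J⊆spanB) (coeffs-ok u J⊆spanB))

  rank-step : ∀ {F x kF kx} → GF2Rank w F kF → GF2Rank w (F ∪ ⁅ x ⁆) kx →
              (kF < kx → ¬ InSpan w F (w x)) × (¬ InSpan w F (w x) → kF < kx)
  rank-step {F} {x} {kF} {kx} RF Rx = grows⇒outside , outside⇒grows
    where
    open Basis (basis RF)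
    grows⇒outside : kF < kx → ¬ InSpan w F (w x)
    grows⇒outside lt sp = NP.<-irrefl refl (NP.<-≤-trans lt (subst (kx ≤_) card (rank-≤ Rx spans′)))
      where
      spans′ : ∀ y → y ∈ F ∪ ⁅ x ⁆ → InSpan w base (w y)
      spans′ y y∈ with ∈∪⁅⁆ y∈
      ... | inj₁ y∈F  = spans y y∈F
      ... | inj₂ refl = span-trans spans sp
    outside⇒grows : ¬ InSpan w F (w x) → kF < kx
    outside⇒grows nsp = subst (_≤ kx) (trans (∣p∪⁅x⁆∣ base x x∉base) (cong suc card))
                          (proj₂ Rx (base ∪ ⁅ x ⁆) (∪⁅⁆-⊆ (SP.p⊆p∪q ⁅ x ⁆ ∘ ⊆S) (SP.q⊆p∪q F ⁅ x ⁆ (SP.x∈⁅x⁆ x)))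
                                 (indep-∪ indep (nsp ∘ span-mono ⊆S)))
      where
      x∉base : x ∉ base
      x∉base x∈ = nsp (span-mono ⊆S (span-mem x∈))

module Graph {v m : ℕ} (ends : Fin m → Fin v × Fin v) where

  Path : Subset m → Fin v → Fin v → Set
  Path = Conn ends

  path-mono : ∀ {P Q x y} → P ⊆ Q → Path P x y → Path Q x y
  path-mono P⊆Q here           = here
  path-mono P⊆Q (step e p e∈ o) = step e (path-mono P⊆Q p) (P⊆Q e∈) o

  path-trans : ∀ {P x y z} → Path P x y → Path P y z → Path P x z
  path-trans p here             = p
  path-trans p (step e q e∈ o)  = step e (path-trans p q) e∈ o

  path-sym : ∀ {P x y} → Path P x y → Path P y x
  path-sym here = here
  path-sym (step e p e∈ o) = path-trans (step e here e∈ (swap o)) (path-sym p)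

  record Labelling (P : Subset m) (lab : Fin v → Fin v) : Set where
    field
      reaches  : ∀ x → Path P x (lab x)
      idem     : ∀ x → lab (lab x) ≡ lab x
      respects : ∀ x y → Path P x y → lab x ≡ lab y
  open Labelling

  no-edges : Labelling ⊥ id
  no-edges = record { reaches = λ _ → here ; idem = λ _ → refl ; respects = λ x y → trivial }
    where
    trivial : ∀ {x y} → Path ⊥ x y → x ≡ y
    trivial here              = refl
    trivial (step e _ e∈⊥ _)  = absurd (∉⊥ e∈⊥)

  merge : (Fin v → Fin v) → Fin v → Fin v → Fin v → Fin v
  merge lab li lj x with lab x F.≟ lj
  ... | yes _ = li
  ... | no _  = lab x

  merge-cong : ∀ lab li lj x y → lab x ≡ lab y → merge lab li lj x ≡ merge lab li lj y
  merge-cong lab li lj x y eq with lab x F.≟ lj | lab y F.≟ lj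
  ... | yes _ | yes _ = refl
  ... | no _  | no _  = eq
  ... | yes a | no b  = absurd (b (trans (sym eq) a))
  ... | no a  | yes b = absurd (a (trans eq b))

  add-edge : ∀ {P lab} → Labelling P lab → (e : Fin m) →
             Labelling (P ∪ ⁅ e ⁆) (merge lab (lab (proj₁ (ends e))) (lab (proj₂ (ends e))))
  add-edge {P} {lab} L e = record { reaches = reaches′ ; idem = idem′ ; respects = respects′ }
    where
    i j : Fin v
    i = proj₁ (ends e)
    j = proj₂ (ends e)
    lab′ : Fin v → Fin v
    lab′ = merge lab (lab i) (lab j)
    P⊆ : P ⊆ P ∪ ⁅ e ⁆
    P⊆ = SP.p⊆p∪q ⁅ e ⁆
    e∈ : e ∈ P ∪ ⁅ e ⁆
    e∈ = SP.q⊆p∪q P ⁅ e ⁆ (SP.x∈⁅x⁆ e)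
    reaches′ : ∀ x → Path (P ∪ ⁅ e ⁆) x (lab′ x)
    reaches′ x with lab x F.≟ lab j
    ... | no _  = path-mono P⊆ (reaches L x)
    ... | yes q = path-trans (path-mono P⊆ x⇝j) (path-trans j⇝i (path-mono P⊆ (reaches L i)))
      where
      x⇝j : Path P x j
      x⇝j = path-trans (subst (Path P x) q (reaches L x)) (path-sym (reaches L j))
      j⇝i : Path (P ∪ ⁅ e ⁆) j i
      j⇝i = step e here e∈ (inj₂ refl)
    idem′ : ∀ x → lab′ (lab′ x) ≡ lab′ x
    idem′ x with lab x F.≟ lab j
    idem′ x | yes _ with lab (lab i) F.≟ lab j
    ... | yes _ = refl
    ... | no _  = idem L i
    idem′ x | no q with lab (lab x) F.≟ lab j
    ... | yes q′ = absurd (q (trans (sym (idem L x)) q′))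
    ... | no _   = idem L x
    ends-merged : lab′ i ≡ lab′ j
    ends-merged with lab i F.≟ lab j | lab j F.≟ lab j
    ... | _     | no ne = absurd (ne refl)
    ... | yes _ | yes _ = refl
    ... | no _  | yes _ = refl
    edge-merged : ∀ {k y} → (ends e ≡ (k , y) ⊎ ends e ≡ (y , k)) → lab′ k ≡ lab′ y
    edge-merged (inj₁ refl) = ends-merged
    edge-merged (inj₂ refl) = sym ends-merged
    respects′ : ∀ x y → Path (P ∪ ⁅ e ⁆) x y → lab′ x ≡ lab′ y
    respects′ x .x here = refl
    respects′ x y (step {k} e′ p e′∈ o) = trans (respects′ x k p) last-edge
      where
      last-edge : lab′ k ≡ lab′ y
      last-edge with ∈∪⁅⁆ e′∈
      ... | inj₁ e′∈P = merge-cong lab (lab i) (lab j) k y (respects L k y (step e′ here e′∈P o))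
      ... | inj₂ refl = edge-merged o

  edgeSet : List (Fin m) → Subset m
  edgeSet []       = ⊥
  edgeSet (e ∷ es) = edgeSet es ∪ ⁅ e ⁆

  label : (es : List (Fin m)) → Σ (Fin v → Fin v) (Labelling (edgeSet es))
  label []       = id , no-edges
  label (e ∷ es) with label es
  ... | lab , L = merge lab (lab (proj₁ (ends e))) (lab (proj₂ (ends e))) , add-edge L e

  edgeSet≡ : ∀ (T : Subset m) → edgeSet (L.filter (SP._∈? T) (L.allFin m)) ≡ T
  edgeSet≡ T = SP.⊆-antisym (λ x∈ → proj₂ (LMP.∈-filter⁻ (SP._∈? T) {xs = L.allFin m} (toList _ x∈)))
                            (λ {x} x∈ → fromList _ (LMP.∈-filter⁺ (SP._∈? T) (LMP.∈-allFin x) x∈))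
    where
    toList : ∀ {x} es → x ∈ edgeSet es → x LM.∈ es
    toList []       x∈ = absurd (∉⊥ x∈)
    toList (e ∷ es) x∈ with ∈∪⁅⁆ x∈
    ... | inj₁ x∈′  = there (toList es x∈′)
    ... | inj₂ refl = here refl
    fromList : ∀ {x} es → x LM.∈ es → x ∈ edgeSet es
    fromList (e ∷ es) (here refl) = SP.q⊆p∪q (edgeSet es) ⁅ e ⁆ (SP.x∈⁅x⁆ e)
    fromList (e ∷ es) (there x∈)  = SP.p⊆p∪q ⁅ e ⁆ (fromList es x∈)

  components : (T : Subset m) → Σ (Fin v → Fin v) (Labelling T)
  components T = subst (λ P → Σ (Fin v → Fin v) (Labelling P)) (edgeSet≡ T) (label (L.filter (SP._∈? T) (L.allFin m)))

⌊⌋-true : ∀ {A : Set} (a? : Dec A) → A → ⌊ a? ⌋ ≡ true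
⌊⌋-true a? a = trans (isYes≗does a?) (dec-true a? a)

∈-image⁺ : ∀ {k n} (f : Fin k → Fin n) (T : Subset k) {e} → e ∈ T → f e ∈ image f T
∈-image⁺ f T {e} e∈T = true⇒∈ (trans (VP.lookup∘tabulate _ (f e)) (any-intro _ e witness))
  where
  witness : (lookup T e ∧ ⌊ f e F.≟ f e ⌋) ≡ true
  witness = cong₂ _∧_ (∈⇒true e∈T) (⌊⌋-true (f e F.≟ f e) refl)
  any-intro : ∀ {k} (p : Fin k → Bool) y → p y ≡ true → anyFin p ≡ true
  any-intro p zero    py = cong (_∨ anyFin (p ∘ suc)) py
  any-intro p (suc y) py with p zero
  ... | true  = refl
  ... | false = any-intro (p ∘ suc) y py

∈-image⁻ : ∀ {k n} (f : Fin k → Fin n) (T : Subset k) {x} → x ∈ image f T → Σ (Fin k) λ e → e ∈ T × f e ≡ x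
∈-image⁻ f T {x} x∈ with any-elim _ (trans (sym (VP.lookup∘tabulate _ x)) (∈⇒true x∈))
  where
  any-elim : ∀ {k} (p : Fin k → Bool) → anyFin p ≡ true → Σ (Fin k) λ y → p y ≡ true
  any-elim {suc k} p e with p zero in p0
  ... | true  = zero , p0
  ... | false with any-elim (p ∘ suc) e
  ...   | y , py = suc y , py
... | y , py with lookup T y in Ty | f y F.≟ x
... | true | yes fy≡x = y , true⇒∈ Ty , fy≡x

image-mono : ∀ {k n} (f : Fin k → Fin n) U U′ → U ⊆ U′ → image f U ⊆ image f U′
image-mono f U U′ U⊆U′ x∈ with ∈-image⁻ f U x∈
... | e , e∈U , refl = ∈-image⁺ f U′ (U⊆U′ e∈U)

sumV-singletons : ∀ {n} (U : Subset n) → sumV ⁅_⁆ U ≡ U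
sumV-singletons []      = refl
sumV-singletons (b ∷ U) = begin
  sumV ⁅_⁆ (b ∷ U)                               ≡⟨ sumV-∷ ⁅_⁆ b U ⟩
  b · ⁅ zero ⁆ ⊕ sumV (λ i → false ∷ ⁅ i ⁆) U     ≡⟨ cong (b · ⁅ zero ⁆ ⊕_) (sumV-head∷tail (λ _ → false) ⁅_⁆ U) ⟩
  b · ⁅ zero ⁆ ⊕ (parity (λ _ → false) U ∷ sumV ⁅_⁆ U)
                                                ≡⟨ cong (λ z → b · ⁅ zero ⁆ ⊕ (z ∷ sumV ⁅_⁆ U)) (parity-false _ U (λ _ _ → refl)) ⟩
  b · ⁅ zero ⁆ ⊕ (false ∷ sumV ⁅_⁆ U)             ≡⟨ cong (λ z → b · ⁅ zero ⁆ ⊕ (false ∷ z)) (sumV-singletons U) ⟩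
  b · ⁅ zero ⁆ ⊕ (false ∷ U)                      ≡⟨ head b ⟩
  b ∷ U                                         ∎
  where
  open ≡-Reasoning
  head : ∀ b → b · ⁅ zero ⁆ ⊕ (false ∷ U) ≡ b ∷ U
  head true  = cong (true ∷_) (⊕-idˡ U)
  head false = cong (false ∷_) (⊕-idˡ U)

-- The
-- vectors W_x + W_{lab x}, x a non-representative vertex, form a basis.

module GraphicRealisation {n r d m : ℕ}
  (w : Fin n → Vec Bool r) (rk : Subset n → ℕ) (rk≡ : ∀ S → GF2Rank w S (rk S))
  (ends : Fin m → Fin (suc d) × Fin (suc d)) (f : Fin m → Fin n) (W : Fin (suc d) → Vec Bool r)
  (f-edge : ∀ e → w (f e) ≡ W (proj₁ (ends e)) ⊕ W (proj₂ (ends e)))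
  (W-dep : ∀ c → sumV W c ≡ zeroV r → c ⊆ ⁅ zero ⁆) where

  open Graph ends
  open Labelling

  path-span : ∀ {T i j} → Path T i j → InSpan (w ∘ f) T (W i ⊕ W j)
  path-span {T} {i} here = subst (InSpan (w ∘ f) T) (sym (⊕-self (W i))) (Span.span-zero (w ∘ f))
  path-span {T} {i} (step {j} {k} e p e∈T o) =
    subst (InSpan (w ∘ f) T) (⊕-telescope (W i) (W j) (W k)) (Span.span-⊕ (w ∘ f) (path-span p) (edge o))
    where
    edge : (ends e ≡ (j , k) ⊎ ends e ≡ (k , j)) → InSpan (w ∘ f) T (W j ⊕ W k)
    edge (inj₁ q) = subst (InSpan (w ∘ f) T) (trans (f-edge e) (cong (λ z → W (proj₁ z) ⊕ W (proj₂ z)) q)) (Span.span-mem (w ∘ f) e∈T)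
    edge (inj₂ q) = subst (InSpan (w ∘ f) T) (trans (f-edge e) (trans (cong (λ z → W (proj₁ z) ⊕ W (proj₂ z)) q) (⊕-comm (W k) (W j)))) (Span.span-mem (w ∘ f) e∈T)

  module _ (T : Subset m) where

    lab : Fin (suc d) → Fin (suc d)
    L : Labelling T lab
    lab = proj₁ (components T)
    L   = proj₂ (components T)

    Reps : Subset (suc d)
    Reps = tabulate (λ x → ⌊ lab x F.≟ x ⌋)

    lab∈Reps : ∀ x → lab x ∈ Reps
    lab∈Reps x = true⇒∈ (trans (VP.lookup∘tabulate (λ y → ⌊ lab y F.≟ y ⌋) (lab x)) (⌊⌋-true (lab (lab x) F.≟ lab x) (idem L x)))

    Reps-fixed : ∀ {x} → x ∈ Reps → lab x ≡ x
    Reps-fixed {x} x∈ with lab x F.≟ x | trans (sym (VP.lookup∘tabulate (λ x → ⌊ lab x F.≟ x ⌋) x)) (∈⇒true x∈)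
    ... | yes e | _ = e

    reps-distinct : ∀ s s′ → s ∈ Reps → s′ ∈ Reps → Path T s s′ → s ≡ s′
    reps-distinct s s′ s∈ s′∈ p = trans (sym (Reps-fixed s∈)) (trans (respects L s s′ p) (Reps-fixed s′∈))

    u : Fin (suc d) → Vec Bool r
    u x = W x ⊕ W (lab x)

    u-span : ∀ j → InSpan w (image f T) (u j)
    u-span j = Span.span-trans (w ∘ f) (λ e e∈T → Span.span-mem w (∈-image⁺ f T e∈T)) (path-span (reaches L j))

    W-to-lab : ∀ y → InSpan u (∁ Reps) (W y ⊕ W (lab y))
    W-to-lab y with y SP.∈? Reps
    ... | yes y∈ = subst (InSpan u (∁ Reps)) (trans (sym (⊕-self (W y))) (cong (λ z → W y ⊕ W z) (sym (Reps-fixed y∈)))) (Span.span-zero u)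
    ... | no y∉  = Span.span-mem u (SP.x∉p⇒x∈∁p y∉)

    -- Each point of f(T) is in the span of the u x: W a + W b = (W a + W_l) + (W b + W_l) for the common label l of a and b.
    image-span : ∀ x → x ∈ image f T → InSpan u (∁ Reps) (w x)
    image-span x x∈ with ∈-image⁻ f T x∈
    ... | e , e∈T , refl = subst (InSpan u (∁ Reps)) eq (Span.span-⊕ u (W-to-lab a) (W-to-lab b))
      where
      a b : Fin (suc d)
      a = proj₁ (ends e)
      b = proj₂ (ends e)
      same : lab a ≡ lab b
      same = respects L a b (step e here e∈T (inj₁ refl))
      eq : (W a ⊕ W (lab a)) ⊕ (W b ⊕ W (lab b)) ≡ w (f e)
      eq = begin
        (W a ⊕ W (lab a)) ⊕ (W b ⊕ W (lab b))   ≡⟨ cong (λ z → (W a ⊕ W (lab a)) ⊕ (W b ⊕ W z)) (sym same) ⟩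
        (W a ⊕ W (lab a)) ⊕ (W b ⊕ W (lab a))   ≡⟨ cong ((W a ⊕ W (lab a)) ⊕_) (⊕-comm (W b) (W (lab a))) ⟩
        (W a ⊕ W (lab a)) ⊕ (W (lab a) ⊕ W b)   ≡⟨ ⊕-telescope (W a) _ (W b) ⟩
        W a ⊕ W b                               ≡⟨ sym (f-edge e) ⟩
        w (f e)                                 ∎
        where open ≡-Reasoning

    -- Independence: a dependency Σ_{x ∈ U} (W x + W (lab x)) = 0 has coefficient
    -- vector U + (labels), which contains U since labels are representatives; by
    -- W-dep it lies in {0}, so U = {0} — but then it also contains lab 0 ≠ 0.
    u-indep : GF2Indep u (∁ Reps)
    u-indep U U⊆∁Reps (x₀ , x₀∈U) Σ≡0 = lab0∉ lab0∈c
      where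
      labs c : Subset (suc d)
      labs = sumV (λ x → ⁅ lab x ⁆) U
      c = sumV (λ x → ⁅ x ⁆ ⊕ ⁅ lab x ⁆) U
      c≡ : c ≡ U ⊕ labs
      c≡ = trans (sumV-fam ⁅_⁆ (λ x → ⁅ lab x ⁆) U) (cong (_⊕ labs) (sumV-singletons U))
      Wc≡0 : sumV W c ≡ zeroV r
      Wc≡0 = trans (sumV-comp W (λ x → ⁅ x ⁆ ⊕ ⁅ lab x ⁆) U)
               (trans (sumV-cong U (λ i _ → trans (sumV-lin W ⁅ i ⁆ ⁅ lab i ⁆) (cong₂ _⊕_ (sumV-⁅⁆ W i) (sumV-⁅⁆ W (lab i))))) Σ≡0)
      c⊆0 : c ⊆ ⁅ zero ⁆
      c⊆0 = W-dep c Wc≡0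
      U⊆c : U ⊆ c
      U⊆c x∈U = subst (_ ∈_) (sym c≡) (∈⊕∉⇒∈ x∈U (λ x∈labs → SP.x∈∁p⇒x∉p (U⊆∁Reps x∈U)
                  (sumV-⊆ (λ x → ⁅ lab x ⁆) U (λ j _ → ⁅⁆⊆ (lab∈Reps j)) x∈labs)))
      U≡0 : U ≡ ⁅ zero ⁆
      U≡0 = SP.⊆-antisym (c⊆0 ∘ U⊆c) (⁅⁆⊆ (subst (_∈ U) (SP.x∈⁅y⁆⇒x≡y zero (c⊆0 (U⊆c x₀∈U))) x₀∈U))
      0∉Reps : zero ∉ Reps
      0∉Reps = SP.x∈∁p⇒x∉p (U⊆∁Reps (subst (zero ∈_) (sym U≡0) (SP.x∈⁅x⁆ zero)))
      lab0∉ : lab zero ∉ ⁅ zero ⁆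
      lab0∉ l∈ = 0∉Reps (subst (_∈ Reps) (SP.x∈⁅y⁆⇒x≡y zero l∈) (lab∈Reps zero))
      lab0∈c : lab zero ∈ ⁅ zero ⁆
      lab0∈c = c⊆0 (subst (lab zero ∈_) (sym (trans c≡ (trans (cong (λ V → V ⊕ sumV (λ x → ⁅ lab x ⁆) V) U≡0)
                     (cong (⁅ zero ⁆ ⊕_) (sumV-⁅⁆ (λ x → ⁅ lab x ⁆) zero)))))
                 (subst (lab zero ∈_) (⊕-comm ⁅ lab zero ⁆ ⁅ zero ⁆) (∈⊕∉⇒∈ (SP.x∈⁅x⁆ (lab zero)) lab0∉)))

    graphic : GraphicRank ends T (rk (image f T))
    graphic = Reps , (λ x → lab x , lab∈Reps x , reaches L x) , reps-distinct ,
              trans (Span.rank-≡ w (rk≡ (image f T)) u (∁ Reps) u-indep (λ j _ → u-span j) image-span)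
                    (SP.∣∁p∣≡n∸∣p∣ Reps)

image-[] : ∀ {n} (f : Fin 0 → Fin n) → image f [] ≡ ⊥
image-[] f = vec-ext λ x → trans (VP.lookup∘tabulate _ x) (sym (lookup-zeroV x))

image-∷ : ∀ {k n} (f : Fin (suc k) → Fin n) b U → image f (b ∷ U) ≡ b · ⁅ f zero ⁆ ∪ image (f ∘ suc) U
image-∷ f b U = vec-ext λ x → begin
  lookup (image f (b ∷ U)) x                                  ≡⟨ VP.lookup∘tabulate _ x ⟩
  (b ∧ ⌊ f zero F.≟ x ⌋) ∨ anyFin (λ y → lookup U y ∧ ⌊ f (suc y) F.≟ x ⌋)
                                                              ≡⟨ cong₂ _∨_ (cong (b ∧_) (sym (lookup-⁅⁆ (f zero) x)))
                                                                            (sym (VP.lookup∘tabulate _ x)) ⟩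
  (b ∧ lookup ⁅ f zero ⁆ x) ∨ lookup (image (f ∘ suc) U) x    ≡⟨ cong (_∨ _) (sym (lookup-· b ⁅ f zero ⁆ x)) ⟩
  lookup (b · ⁅ f zero ⁆) x ∨ lookup (image (f ∘ suc) U) x    ≡⟨ sym (VP.lookup-zipWith _∨_ x (b · ⁅ f zero ⁆) (image (f ∘ suc) U)) ⟩
  lookup (b · ⁅ f zero ⁆ ∪ image (f ∘ suc) U) x               ∎
  where open ≡-Reasoning

disjoint-∪ : ∀ {n} (p q : Subset n) → (∀ {i} → i ∈ p → i ∉ q) → p ∪ q ≡ p ⊕ q
disjoint-∪ p q disj = vec-ext λ i → trans (VP.lookup-zipWith _∨_ i p q) (trans (pointwise i) (sym (lookup-⊕ p q i)))
  where
  pointwise : ∀ i → lookup p i ∨ lookup q i ≡ lookup p i xor lookup q i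
  pointwise i with lookup p i in ep | lookup q i in eq
  ... | true  | true  = absurd (disj (true⇒∈ ep) (true⇒∈ eq))
  ... | true  | false = refl
  ... | false | _     = refl

module InjectiveImage {k n : ℕ} (f : Fin k → Fin n) (f-inj : Injective _≡_ _≡_ f) where

  head∉tail : ∀ {k} (f : Fin (suc k) → Fin n) → Injective _≡_ _≡_ f → ∀ U → f zero ∉ image (f ∘ suc) U
  head∉tail f inj U x∈ with ∈-image⁻ (f ∘ suc) U x∈
  ... | e , _ , fe≡f0 with inj fe≡f0
  ... | ()

  sumV-image : ∀ {r} (w : Fin n → Vec Bool r) U → sumV w (image f U) ≡ sumV (w ∘ f) U
  sumV-image w U = go f f-inj U
    where
    go : ∀ {k} (f : Fin k → Fin n) → Injective _≡_ _≡_ f → ∀ U → sumV w (image f U) ≡ sumV (w ∘ f) U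
    go f inj []      = trans (cong (sumV w) (image-[] f)) (sumV-⊥ w)
    go f inj (b ∷ U) = begin
      sumV w (image f (b ∷ U))                          ≡⟨ cong (sumV w) (image-∷ f b U) ⟩
      sumV w (b · ⁅ f zero ⁆ ∪ image (f ∘ suc) U)        ≡⟨ cong (sumV w) (disjoint-∪ _ _ disj) ⟩
      sumV w (b · ⁅ f zero ⁆ ⊕ image (f ∘ suc) U)        ≡⟨ sumV-lin w _ _ ⟩
      sumV w (b · ⁅ f zero ⁆) ⊕ sumV w (image (f ∘ suc) U)
                                                        ≡⟨ cong₂ _⊕_ (trans (sumV-· w b _) (cong (b ·_) (sumV-⁅⁆ w (f zero))))
                                                                     (go (f ∘ suc) (λ e → FP.suc-injective (inj e)) U) ⟩
      b · w (f zero) ⊕ sumV (w ∘ f ∘ suc) U              ≡⟨ sym (sumV-∷ (w ∘ f) b U) ⟩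
      sumV (w ∘ f) (b ∷ U)                              ∎
      where
      open ≡-Reasoning
      disj : ∀ {i} → i ∈ b · ⁅ f zero ⁆ → i ∉ image (f ∘ suc) U
      disj i∈ = subst (_∉ _) (sym (SP.x∈⁅y⁆⇒x≡y _ (·-⊆ b SP.⊆-refl i∈))) (head∉tail f inj U)

  ∣image∣ : ∀ U → ∣ image f U ∣ ≡ ∣ U ∣
  ∣image∣ U = go f f-inj U
    where
    go : ∀ {k} (f : Fin k → Fin n) → Injective _≡_ _≡_ f → ∀ U → ∣ image f U ∣ ≡ ∣ U ∣
    go f inj []          = trans (cong ∣_∣ (image-[] f)) (SP.∣⊥∣≡0 n)
    go f inj (false ∷ U) = trans (cong ∣_∣ (trans (image-∷ f false U) (SP.∪-identityˡ _))) (go (f ∘ suc) (λ e → FP.suc-injective (inj e)) U)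
    go f inj (true ∷ U)  = begin
      ∣ image f (true ∷ U) ∣                 ≡⟨ cong ∣_∣ (trans (image-∷ f true U) (SP.∪-comm _ _)) ⟩
      ∣ image (f ∘ suc) U ∪ ⁅ f zero ⁆ ∣     ≡⟨ ∣p∪⁅x⁆∣ _ (f zero) (head∉tail f inj U) ⟩
      suc ∣ image (f ∘ suc) U ∣              ≡⟨ cong suc (go (f ∘ suc) (λ e → FP.suc-injective (inj e)) U) ⟩
      suc ∣ U ∣                              ∎
      where open ≡-Reasoning

  image-injective-∈ : ∀ U {i} → f i ∈ image f U → i ∈ U
  image-injective-∈ U x∈ with ∈-image⁻ f U x∈
  ... | e , e∈U , fe≡fi = subst (_∈ U) (f-inj fe≡fi) e∈U

  preimage : Subset n → Subset k
  preimage V = tabulate (λ i → lookup V (f i))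

  ∈-preimage⁺ : ∀ {V i} → f i ∈ V → i ∈ preimage V
  ∈-preimage⁺ {V} {i} fi∈ = true⇒∈ (trans (VP.lookup∘tabulate (λ i → lookup V (f i)) i) (∈⇒true fi∈))

  ∈-preimage⁻ : ∀ {V i} → i ∈ preimage V → f i ∈ V
  ∈-preimage⁻ {V} {i} i∈ = true⇒∈ (trans (sym (VP.lookup∘tabulate (λ i → lookup V (f i)) i)) (∈⇒true i∈))

  image-preimage : ∀ V U → V ⊆ image f U → image f (preimage V) ≡ V
  image-preimage V U V⊆img = SP.⊆-antisym ⊆V V⊆
    where
    ⊆V : image f (preimage V) ⊆ V
    ⊆V x∈ with ∈-image⁻ f (preimage V) x∈
    ... | e , e∈ , refl = ∈-preimage⁻ e∈
    V⊆ : V ⊆ image f (preimage V)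
    V⊆ x∈V with ∈-image⁻ f U (V⊆img x∈V)
    ... | e , _ , refl = ∈-image⁺ f (preimage V) (∈-preimage⁺ x∈V)

  preimage-⊆ : ∀ V U → V ⊆ image f U → preimage V ⊆ U
  preimage-⊆ V U V⊆ i∈ = image-injective-∈ U (V⊆ (∈-preimage⁻ i∈))

  indep-image⁻ : ∀ {r} {w : Fin n → Vec Bool r} {T} → GF2Indep w (image f T) → GF2Indep (w ∘ f) T
  indep-image⁻ {w = w} {T} indep U U⊆T (i , i∈U) ΣU≡0 =
    indep (image f U) (image-mono f U T U⊆T) (f i , ∈-image⁺ f U i∈U) (trans (sumV-image w U) ΣU≡0)

  indep-image⁺ : ∀ {r} {w : Fin n → Vec Bool r} {T} → GF2Indep (w ∘ f) T → GF2Indep w (image f T)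
  indep-image⁺ {w = w} {T} indep V V⊆ (x , x∈V) ΣV≡0 with ∈-image⁻ f T (V⊆ x∈V)
  ... | e , _ , refl =
    indep (preimage V) (preimage-⊆ V T V⊆) (e , ∈-preimage⁺ x∈V)
          (trans (sym (sumV-image w (preimage V))) (trans (cong (sumV w) (image-preimage V T V⊆)) ΣV≡0))

  rank-image : ∀ {r} {w : Fin n → Vec Bool r} {T k} → GF2Rank w (image f T) k → GF2Rank (w ∘ f) T k
  rank-image {w = w} {T} {k} ((B , B⊆ , indepB , ∣B∣≡k) , maximal) =
    (preimage B , preimage-⊆ B T B⊆ , indep-image⁻ (subst (GF2Indep w) (sym (image-preimage B T B⊆)) indepB) ,
     trans (sym (∣image∣ (preimage B))) (trans (cong ∣_∣ (image-preimage B T B⊆)) ∣B∣≡k)) ,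
    λ T₀ T₀⊆T indep₀ → subst (_≤ k) (∣image∣ T₀) (maximal (image f T₀) (image-mono f T₀ T T₀⊆T) (indep-image⁺ indep₀))

-- Rank is invariant under an injective linear change of coordinates: if
-- u i = L (g i) where L = (Σ over the columns bb) has trivial kernel, then u and g
-- have the same independent sets, hence the same ranks.
rank-linear : ∀ {k r s} (u : Fin k → Vec Bool r) (g : Fin k → Vec Bool s) (bb : Fin s → Vec Bool r) →
              (∀ c → sumV bb c ≡ zeroV r → c ≡ zeroV s) → (∀ i → u i ≡ sumV bb (g i)) →
              ∀ {T k′} → GF2Rank u T k′ → GF2Rank g T k′
rank-linear {r = r} {s} u g bb ker u≡ ((B , B⊆ , indepB , ∣B∣) , maximal) =
  (B , B⊆ , indep⇒ indepB , ∣B∣) , λ T₀ T₀⊆ indep₀ → maximal T₀ T₀⊆ (indep⇐ indep₀)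
  where
  Σu≡ : ∀ U → sumV u U ≡ sumV bb (sumV g U)
  Σu≡ U = trans (sumV-cong U (λ i _ → u≡ i)) (sym (sumV-comp bb g U))
  indep⇒ : ∀ {T} → GF2Indep u T → GF2Indep g T
  indep⇒ indep U U⊆ U≠∅ Σg≡0 = indep U U⊆ U≠∅ (trans (Σu≡ U) (trans (cong (sumV bb) Σg≡0) (sumV-⊥ bb)))
  indep⇐ : ∀ {T} → GF2Indep g T → GF2Indep u T
  indep⇐ indep U U⊆ U≠∅ Σu≡0 = indep U U⊆ U≠∅ (ker (sumV g U) (trans (sym (Σu≡ U)) Σu≡0))

-- The edges of K_v: E v = v(v-1)/2 edges, edge e joining endsK v e = (i , j), i < j.
E : ℕ → ℕ
E zero    = 0
E (suc v) = v + E v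

shift : ∀ {v} → Fin v × Fin v → Fin (suc v) × Fin (suc v)
shift (i , j) = suc i , suc j

endsK : ∀ v → Fin (E v) → Fin v × Fin v
endsK (suc v) e = [ (λ j → zero , suc j) , (λ e′ → shift (endsK v e′)) ]′ (F.splitAt v e)

endsK-< : ∀ v e → proj₁ (endsK v e) F.< proj₂ (endsK v e)
endsK-< (suc v) e with F.splitAt v e
... | inj₁ j  = s≤s z≤n
... | inj₂ e′ = s≤s (endsK-< v e′)

endsK-onto : ∀ v (i j : Fin v) → i F.< j → Σ (Fin (E v)) λ e → endsK v e ≡ (i , j)
endsK-onto (suc v) zero    (suc j) _ = j F.↑ˡ E v , cong [ _ , _ ]′ (FP.splitAt-↑ˡ v j (E v))
endsK-onto (suc v) (suc i) (suc j) i<j with endsK-onto v i j (NP.≤-pred i<j)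
... | e′ , e′-ends = v F.↑ʳ e′ , trans (cong [ _ , _ ]′ (FP.splitAt-↑ʳ v (E v) e′)) (cong shift e′-ends)

shift-injective : ∀ {v} {p q : Fin v × Fin v} → shift p ≡ shift q → p ≡ q
shift-injective {p = _ , _} {_ , _} refl = refl

endsK-injective : ∀ v {e₁ e₂} → endsK v e₁ ≡ endsK v e₂ → e₁ ≡ e₂
endsK-injective (suc v) {e₁} {e₂} eq with F.splitAt v e₁ in s₁ | F.splitAt v e₂ in s₂
... | inj₁ j₁ | inj₁ j₂ = trans (sym (FP.splitAt⁻¹-↑ˡ s₁)) (trans (cong (F._↑ˡ E v) (FP.suc-injective (cong proj₂ eq))) (FP.splitAt⁻¹-↑ˡ s₂))
... | inj₂ e₁′ | inj₂ e₂′ = trans (sym (FP.splitAt⁻¹-↑ʳ s₁))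
      (trans (cong (v F.↑ʳ_) (endsK-injective v (shift-injective eq)))
             (FP.splitAt⁻¹-↑ʳ s₂))
... | inj₁ _ | inj₂ _ with () ← cong proj₁ eq
... | inj₂ _ | inj₁ _ with () ← cong proj₁ eq

completeK : ∀ v → CompleteEdges (endsK v)
completeK v = endsK-< v , endsK-onto v , endsK-injective v

record Enumeration {n} (T : Subset n) (k : ℕ) : Set where
  field
    elem   : Fin k → Fin n
    inj    : ∀ {i j} → elem i ≡ elem j → i ≡ j
    member : ∀ i → elem i ∈ T
    onto   : ∀ x → x ∈ T → Σ (Fin k) λ i → elem i ≡ x

enumerate : ∀ {n} (T : Subset n) → Enumeration T ∣ T ∣
enumerate [] = record { elem = λ () ; inj = λ { {()} } ; member = λ () ; onto = λ _ () }
enumerate (false ∷ T) = record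
  { elem = suc ∘ elem ; inj = inj ∘ FP.suc-injective ; member = V.there ∘ member
  ; onto = λ { (suc x) (V.there x∈) → map₂ (cong suc) (onto x x∈) } }
  where open Enumeration (enumerate T)
enumerate (true ∷ T) = record { elem = elem′ ; inj = inj′ ; member = member′ ; onto = onto′ }
  where
  open Enumeration (enumerate T)
  elem′ : Fin (suc ∣ T ∣) → Fin _
  elem′ zero    = zero
  elem′ (suc i) = suc (elem i)
  inj′ : ∀ {i j} → elem′ i ≡ elem′ j → i ≡ j
  inj′ {zero}  {zero}  _ = refl
  inj′ {suc i} {suc j} e = cong suc (inj (FP.suc-injective e))
  member′ : ∀ i → elem′ i ∈ true ∷ T
  member′ zero    = V.here
  member′ (suc i) = V.there (member i)
  onto′ : ∀ x → x ∈ true ∷ T → Σ _ λ i → elem′ i ≡ x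
  onto′ zero    _            = zero , refl
  onto′ (suc x) (V.there x∈) = map× suc (cong suc) (onto x x∈)

subset-of-size : ∀ {n} (T : Subset n) k → k ≤ ∣ T ∣ → Σ (Subset n) λ T′ → T′ ⊆ T × ∣ T′ ∣ ≡ k
subset-of-size {n} T zero _ = ⊥ , zeroV-⊆ , SP.∣⊥∣≡0 n
subset-of-size (false ∷ T) (suc k) k≤ with subset-of-size T (suc k) k≤
... | T′ , T′⊆ , ∣T′∣ = (false ∷ T′) , SP.s⊆s T′⊆ , ∣T′∣
subset-of-size (true ∷ T) (suc k) k≤ with subset-of-size T k (NP.≤-pred k≤)
... | T′ , T′⊆ , ∣T′∣ = (true ∷ T′) , SP.s⊆s T′⊆ , cong suc ∣T′∣

⊆-by-card : ∀ {n} {T S : Subset n} → T ⊆ S → ∣ S ∣ ≤ ∣ T ∣ → S ⊆ T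
⊆-by-card {T = T} {S} T⊆S ∣S∣≤∣T∣ {x} x∈S with x SP.∈? T
... | yes x∈T = x∈T
... | no x∉T  = absurd (NP.<-irrefl refl (NP.≤-trans (SP.x∈p⇒∣p-x∣<∣p∣ x∈S) (NP.≤-trans ∣S∣≤∣T∣ (SP.p⊆q⇒∣p∣≤∣q∣ T⊆S-x))))
  where
  T⊆S-x : T ⊆ S - x
  T⊆S-x y∈T = SP.x∈p∧x≢y⇒x∈p-y (T⊆S y∈T) λ { refl → x∉T y∈T }

∈pair⁻ : ∀ {n} {a c x : Fin n} → x ∈ ⁅ a ⁆ ⊕ ⁅ c ⁆ → x ≡ a ⊎ x ≡ c
∈pair⁻ {a = a} {c} x∈ with ∈∪⁅⁆ (⊕-⊆ (SP.p⊆p∪q ⁅ c ⁆) (SP.q⊆p∪q ⁅ a ⁆ ⁅ c ⁆) x∈)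
... | inj₁ x∈a = inj₁ (SP.x∈⁅y⁆⇒x≡y a x∈a)
... | inj₂ x≡c = inj₂ x≡c

∈pairˡ : ∀ {n} {a c : Fin n} → a ≢ c → a ∈ ⁅ a ⁆ ⊕ ⁅ c ⁆
∈pairˡ a≢c = ∈⊕∉⇒∈ (SP.x∈⁅x⁆ _) (SP.x≢y⇒x∉⁅y⁆ a≢c)

∈pairʳ : ∀ {n} {a c : Fin n} → a ≢ c → c ∈ ⁅ a ⁆ ⊕ ⁅ c ⁆
∈pairʳ {a = a} {c} a≢c = subst (c ∈_) (⊕-comm ⁅ c ⁆ ⁅ a ⁆) (∈pairˡ (a≢c ∘ sym))

agree-off-zero : ∀ {d} {P Q : Subset (suc d)} {x} → P ⊕ Q ⊆ ⁅ zero ⁆ → x ≢ zero → x ∈ P → x ∈ Q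
agree-off-zero {Q = Q} {x} P⊕Q⊆0 x≢0 x∈P with x SP.∈? Q
... | yes x∈Q = x∈Q
... | no x∉Q  = absurd (x≢0 (SP.x∈⁅y⁆⇒x≡y zero (P⊕Q⊆0 (∈⊕∉⇒∈ x∈P x∉Q))))

⊕-comm-⊆ : ∀ {n} {P Q R : Subset n} → P ⊕ Q ⊆ R → Q ⊕ P ⊆ R
⊕-comm-⊆ {P = P} {Q} {R} = subst (_⊆ R) (⊕-comm P Q)

edge-determined : ∀ {d} {a₁ c₁ a₂ c₂ : Fin (suc d)} → a₁ F.< c₁ → a₂ F.< c₂ →
                  (⁅ a₁ ⁆ ⊕ ⁅ c₁ ⁆) ⊕ (⁅ a₂ ⁆ ⊕ ⁅ c₂ ⁆) ⊆ ⁅ zero ⁆ → a₁ ≡ a₂ × c₁ ≡ c₂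
edge-determined {a₁ = a₁} {c₁} {a₂} {c₂} a₁<c₁ a₂<c₂ diff⊆0 with c₁ F.≟ c₂
... | yes refl = a-agree , refl
  where
  a-agree : a₁ ≡ a₂
  a-agree with a₁ F.≟ zero | a₂ F.≟ zero
  ... | yes a₁≡0 | yes a₂≡0 = trans a₁≡0 (sym a₂≡0)
  ... | no a₁≢0 | _ with ∈pair⁻ (agree-off-zero diff⊆0 a₁≢0 (∈pairˡ (FP.<⇒≢ a₁<c₁)))
  ...   | inj₁ a₁≡a₂ = a₁≡a₂
  ...   | inj₂ a₁≡c₁ = absurd (FP.<⇒≢ a₁<c₁ a₁≡c₁)
  a-agree | yes _ | no a₂≢0 with ∈pair⁻ (agree-off-zero (⊕-comm-⊆ diff⊆0) a₂≢0 (∈pairˡ (FP.<⇒≢ a₂<c₂)))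
  ...   | inj₁ a₂≡a₁ = sym a₂≡a₁
  ...   | inj₂ a₂≡c₁ = absurd (FP.<⇒≢ a₂<c₂ a₂≡c₁)
... | no c₁≢c₂ with ∈pair⁻ (agree-off-zero diff⊆0 (nonzero a₁<c₁) (∈pairʳ (FP.<⇒≢ a₁<c₁)))
                  | ∈pair⁻ (agree-off-zero (⊕-comm-⊆ diff⊆0) (nonzero a₂<c₂) (∈pairʳ (FP.<⇒≢ a₂<c₂)))
  where
  nonzero : ∀ {d} {a c : Fin (suc d)} → a F.< c → c ≢ zero
  nonzero () refl
...   | inj₂ c₁≡c₂ | _          = absurd (c₁≢c₂ c₁≡c₂)
...   | inj₁ _     | inj₂ c₂≡c₁ = absurd (c₁≢c₂ (sym c₂≡c₁))
...   | inj₁ refl  | inj₁ refl  = absurd (FP.<-irrefl refl (FP.<-trans a₁<c₁ a₂<c₂))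

rank-full : ∀ {n r} {w : Fin n → Vec Bool r} {S} → GF2Rank w S ∣ S ∣ → GF2Indep w S
rank-full ((T , T⊆S , indepT , ∣T∣≡∣S∣) , _) U U⊆S = indepT U (⊆-by-card T⊆S (NP.≤-reflexive (sym ∣T∣≡∣S∣)) ∘ U⊆S)

∣pair∣ : ∀ {n} {x y : Fin n} → x ≢ y → ∣ ⁅ x ⁆ ∪ ⁅ y ⁆ ∣ ≡ 2
∣pair∣ {x = x} {y} x≢y = trans (∣p∪⁅x⁆∣ ⁅ x ⁆ y (λ y∈ → x≢y (sym (SP.x∈⁅y⁆⇒x≡y x y∈)))) (cong suc (SP.∣⁅x⁆∣≡1 x))

⊆⁅⁆ : ∀ {n} {U : Subset n} {q} → U ⊆ ⁅ q ⁆ → U ≡ ⊥ ⊎ U ≡ ⁅ q ⁆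
⊆⁅⁆ {U = U} {q} U⊆ with q SP.∈? U
... | yes q∈U = inj₂ (SP.⊆-antisym U⊆ (⁅⁆⊆ q∈U))
... | no q∉U  = inj₁ (SP.Empty-unique λ { (x , x∈U) → q∉U (subst (_∈ U) (SP.x∈⁅y⁆⇒x≡y q (U⊆ x∈U)) x∈U) })

pair-without : ∀ {n} {U : Subset n} {p q} → U ⊆ ⁅ p ⁆ ∪ ⁅ q ⁆ → p ∉ U → U ⊆ ⁅ q ⁆
pair-without {U = U} {p} U⊆ p∉U x∈U with ∈∪⁅⁆ (U⊆ x∈U)
... | inj₁ x∈p  = absurd (p∉U (subst (_∈ U) (SP.x∈⁅y⁆⇒x≡y p x∈p) x∈U))
... | inj₂ refl = SP.x∈⁅x⁆ _

pair-minus : ∀ {n} {U : Subset n} {p q} → U ⊆ ⁅ p ⁆ ∪ ⁅ q ⁆ → U - p ⊆ ⁅ q ⁆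
pair-minus {p = p} U⊆ x∈ with ∈∪⁅⁆ (U⊆ (proj₁ (∈-─ x∈)))
... | inj₁ x∈p  = absurd (proj₂ (∈-─ x∈) (sym (SP.x∈⁅y⁆⇒x≡y p x∈p)))
... | inj₂ refl = SP.x∈⁅x⁆ _

module SimpleBinary {n r : ℕ} (rk : Subset n → ℕ) (vec : Fin n → Vec Bool r)
                    (rk≡ : ∀ S → GF2Rank vec S (rk S)) (simple : Simple rk) where

  open Span vec

  point-indep : ∀ x → GF2Indep vec ⁅ x ⁆
  point-indep x = rank-full (subst (GF2Rank vec ⁅ x ⁆) (trans (proj₁ simple x) (sym (SP.∣⁅x⁆∣≡1 x))) (rk≡ ⁅ x ⁆))

  pair-indep : ∀ {x y} → x ≢ y → GF2Indep vec (⁅ x ⁆ ∪ ⁅ y ⁆)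
  pair-indep {x} {y} x≢y = rank-full (subst (GF2Rank vec _) (trans (proj₂ simple x y x≢y) (sym (∣pair∣ x≢y))) (rk≡ _))

  vec-nonzero : ∀ y → vec y ≢ zeroV r
  vec-nonzero y = point-indep y ⁅ y ⁆ SP.⊆-refl (y , SP.x∈⁅x⁆ y) ∘ trans (sumV-⁅⁆ vec y)

  vec-injective : ∀ {x y} → vec x ≡ vec y → x ≡ y
  vec-injective {x} {y} vx≡vy with x F.≟ y
  ... | yes x≡y = x≡y
  ... | no x≢y  = absurd (pair-indep x≢y _ SP.⊆-refl (x , SP.p⊆p∪q ⁅ y ⁆ (SP.x∈⁅x⁆ x)) Σ≡0)
    where
    Σ≡0 : sumV vec (⁅ x ⁆ ∪ ⁅ y ⁆) ≡ zeroV r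
    Σ≡0 = begin
      sumV vec (⁅ x ⁆ ∪ ⁅ y ⁆)         ≡⟨ cong (sumV vec) (disjoint-∪ ⁅ x ⁆ ⁅ y ⁆ λ i∈x i∈y → x≢y (trans (sym (SP.x∈⁅y⁆⇒x≡y x i∈x)) (SP.x∈⁅y⁆⇒x≡y y i∈y))) ⟩
      sumV vec (⁅ x ⁆ ⊕ ⁅ y ⁆)         ≡⟨ sumV-lin vec ⁅ x ⁆ ⁅ y ⁆ ⟩
      sumV vec ⁅ x ⁆ ⊕ sumV vec ⁅ y ⁆  ≡⟨ cong₂ _⊕_ (sumV-⁅⁆ vec x) (sumV-⁅⁆ vec y) ⟩
      vec x ⊕ vec y                    ≡⟨ cong (_⊕ vec y) vx≡vy ⟩
      vec y ⊕ vec y                    ≡⟨ ⊕-self (vec y) ⟩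
      zeroV r                          ∎
      where open ≡-Reasoning

  span-point : ∀ {U q} → U ⊆ ⁅ q ⁆ → sumV vec U ≡ zeroV r ⊎ sumV vec U ≡ vec q
  span-point {q = q} U⊆ with ⊆⁅⁆ U⊆
  ... | inj₁ refl = inj₁ (sumV-⊥ vec)
  ... | inj₂ refl = inj₂ (sumV-⁅⁆ vec q)

  span-pair : ∀ {U p q} → U ⊆ ⁅ p ⁆ ∪ ⁅ q ⁆ →
              sumV vec U ≡ zeroV r ⊎ sumV vec U ≡ vec q ⊎ sumV vec U ≡ vec p ⊎ sumV vec U ≡ vec q ⊕ vec p
  span-pair {U} {p} {q} U⊆ with p SP.∈? U
  ... | no p∉U with span-point (pair-without U⊆ p∉U)
  ...   | inj₁ Σ≡0  = inj₁ Σ≡0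
  ...   | inj₂ Σ≡vq = inj₂ (inj₁ Σ≡vq)
  span-pair {U} {p} {q} U⊆ | yes p∈U with span-point (pair-minus U⊆)
  ...   | inj₁ Σ≡0  = inj₂ (inj₂ (inj₁ (trans (sumV-split-off vec U p p∈U) (trans (cong (_⊕ vec p) Σ≡0) (⊕-idˡ (vec p))))))
  ...   | inj₂ Σ≡vq = inj₂ (inj₂ (inj₂ (trans (sumV-split-off vec U p p∈U) (cong (_⊕ vec p) Σ≡vq))))

  third-point : ∀ {p q y} → y ≢ p → y ≢ q → InSpan vec (⁅ p ⁆ ∪ ⁅ q ⁆) (vec y) → vec y ≡ vec p ⊕ vec q
  third-point {p} {q} {y} y≢p y≢q (U , U⊆ , ΣU≡vy) with span-pair U⊆
  ... | inj₁ Σ≡0                = absurd (vec-nonzero y (trans (sym ΣU≡vy) Σ≡0))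
  ... | inj₂ (inj₁ Σ≡vq)        = absurd (y≢q (vec-injective (trans (sym ΣU≡vy) Σ≡vq)))
  ... | inj₂ (inj₂ (inj₁ Σ≡vp)) = absurd (y≢p (vec-injective (trans (sym ΣU≡vy) Σ≡vp)))
  ... | inj₂ (inj₂ (inj₂ Σ≡vqp)) = trans (sym ΣU≡vy) (trans Σ≡vqp (⊕-comm (vec q) (vec p)))

  flat-by-span : ∀ {E F} → F ⊆ E → (∀ x → x ∈ E → x ∉ F → ¬ InSpan vec F (vec x)) → FlatIn rk E F
  flat-by-span F⊆E closed = F⊆E , λ x x∈E x∉F → proj₂ (rank-step (rk≡ _) (rk≡ _)) (closed x x∈E x∉F)

  flat-closed : ∀ {E F x} → FlatIn rk E F → x ∈ E → InSpan vec F (vec x) → x ∈ F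
  flat-closed {F = F} {x} (_ , grows) x∈E sp with x SP.∈? F
  ... | yes x∈F = x∈F
  ... | no x∉F  = absurd (proj₁ (rank-step (rk≡ F) (rk≡ (F ∪ ⁅ x ⁆))) (grows x x∈E x∉F) sp)

  -- The closure of A: all points whose vector lies in the span of A.
  -- It is opaque: only cl⁺ and cl⁻ are needed, and unfolding the search is costly.
  opaque
    cl : Subset n → Subset n
    cl A = tabulate (λ y → ⌊ inSpan? A (vec y) ⌋)

    cl⁺ : ∀ {A y} → InSpan vec A (vec y) → y ∈ cl A
    cl⁺ {A} {y} sp = true⇒∈ (trans (VP.lookup∘tabulate (λ y → ⌊ inSpan? A (vec y) ⌋) y) (⌊⌋-true (inSpan? A (vec y)) sp))

    cl⁻ : ∀ {A y} → y ∈ cl A → InSpan vec A (vec y)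
    cl⁻ {A} {y} y∈ = toWitness {a? = inSpan? A (vec y)}
      (subst B.T (sym (trans (sym (VP.lookup∘tabulate (λ y → ⌊ inSpan? A (vec y) ⌋) y)) (∈⇒true y∈))) tt)

  cl-flat : ∀ A → FlatIn rk ⊤ (cl A)
  cl-flat A = flat-by-span (λ _ → ∈⊤) λ x _ x∉ sp → x∉ (cl⁺ (span-trans (λ y y∈ → cl⁻ y∈) sp))

sumV-pair : ∀ {n r} (w : Fin n → Vec Bool r) a c → sumV w (⁅ a ⁆ ⊕ ⁅ c ⁆) ≡ w a ⊕ w c
sumV-pair w a c = trans (sumV-lin w ⁅ a ⁆ ⁅ c ⁆) (cong₂ _⊕_ (sumV-⁅⁆ w a) (sumV-⁅⁆ w c))

module ModularCopoint {n r : ℕ} (M : Matroid n) (vec : Fin n → Vec Bool r)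
         (rk≡ : ∀ S → GF2Rank vec S (Matroid.rk M S)) (simple : Simple (Matroid.rk M))
         (X : Subset n) (copoint : Copoint (Matroid.rk M) X) (modular : ModularIn (Matroid.rk M) ⊤ X) where

  open Matroid M
  open Span vec
  open SimpleBinary rk vec rk≡ simple

  D : Subset n
  D = ∁ X

  X-flat : FlatIn rk ⊤ X
  X-flat = proj₁ copoint

  X-closed : ∀ {x} → InSpan vec X (vec x) → x ∈ X
  X-closed = flat-closed X-flat ∈⊤

  sum-in-X : ∀ {p q} → p ≢ q → p ∉ X → q ∉ X → Σ (Fin n) λ x → x ∈ X × vec x ≡ vec p ⊕ vec q
  sum-in-X {p} {q} p≢q p∉X q∉X = x , x∈X , third-point (λ x≡p → p∉X (subst (_∈ X) x≡p x∈X)) (λ x≡q → q∉X (subst (_∈ X) x≡q x∈X)) (cl⁻ x∈L)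
    where
    P L : Subset n
    P = ⁅ p ⁆ ∪ ⁅ q ⁆
    L = cl P
    P⊆L : P ⊆ L
    P⊆L x∈P = cl⁺ (span-mem x∈P)
    rk-L : rk L ≡ 2
    rk-L = trans (rank-≡ (rk≡ L) vec P (pair-indep p≢q) (λ j j∈P → span-mem (P⊆L j∈P)) (λ x x∈L → cl⁻ x∈L)) (∣pair∣ p≢q)
    rk-X∪L : rk (X ∪ L) ≡ suc (rk X)
    rk-X∪L = NP.≤-antisym (NP.≤-trans (rk-mono (X ∪ L) ⊤ SP.⊆⊤) (NP.≤-reflexive (sym (proj₂ copoint))))
               (NP.≤-trans (proj₂ X-flat p ∈⊤ p∉X) (rk-mono (X ∪ ⁅ p ⁆) (X ∪ L) (∪⁅⁆-⊆ (SP.p⊆p∪q L) (SP.q⊆p∪q X L (P⊆L (SP.p⊆p∪q ⁅ q ⁆ (SP.x∈⁅x⁆ p)))))))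
    meet : Nonempty (X ∩ L)
    meet = proj₂ modular L (cl-flat P , rk-L) rk-X∪L
    x : Fin n
    x = proj₁ meet
    x∈X : x ∈ X
    x∈X = proj₁ (SP.x∈p∩q⁻ X L (proj₂ meet))
    x∈L : x ∈ L
    x∈L = proj₂ (SP.x∈p∩q⁻ X L (proj₂ meet))

  -- Together with
  -- the points b_i + b_j of X it forms an M(K_{d+1}) on vertices 0, …, d, where
  -- vertex 0 carries the zero vector and vertex i+1 the vector b_i.
  module Frame {d : ℕ} (B : Subset n) (B⊆D : B ⊆ D) (indepB : GF2Indep vec B) (enum : Enumeration B d) where

    open Enumeration enum renaming (elem to β; inj to β-inj; member to β∈B; onto to β-onto)

    b : Fin d → Vec Bool r
    b = vec ∘ β

    β∉X : ∀ i → β i ∉ X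
    β∉X i = SP.x∈∁p⇒x∉p (B⊆D (β∈B i))

    b-kernel : ∀ c → sumV b c ≡ zeroV r → c ≡ ⊥
    b-kernel c Σ≡0 with SP.nonempty? c
    ... | no c≡∅  = SP.Empty-unique c≡∅
    ... | yes c≠∅ = absurd (indep-b c SP.⊆⊤ c≠∅ Σ≡0)
      where
      indep-b : GF2Indep b ⊤
      indep-b = InjectiveImage.indep-image⁻ β β-inj (λ U U⊆ → indepB U (image-⊆B ∘ U⊆))
        where
        image-⊆B : image β ⊤ ⊆ B
        image-⊆B x∈ with ∈-image⁻ β ⊤ x∈
        ... | i , _ , refl = β∈B i

    b-sum-injective : ∀ {c c′} → sumV b c ≡ sumV b c′ → c ≡ c′
    b-sum-injective {c} {c′} Σ≡ = ⊕-cancel c c′ (b-kernel (c ⊕ c′) (trans (sumV-lin b c c′) (trans (cong (_⊕ sumV b c′) Σ≡) (⊕-self _))))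

    W : Fin (suc d) → Vec Bool r
    W zero    = zeroV r
    W (suc i) = b i

    sumV-W : ∀ c → sumV W c ≡ sumV b (V.tail c)
    sumV-W (true ∷ t)  = ⊕-idˡ _
    sumV-W (false ∷ t) = refl

    W-dep : ∀ c → sumV W c ≡ zeroV r → c ⊆ ⁅ zero ⁆
    W-dep (h ∷ t) Σ≡0 V.here         = V.here
    W-dep (h ∷ t) Σ≡0 (V.there i∈t) = absurd (∉⊥ (subst (_ ∈_) (b-kernel t (trans (sym (sumV-W (h ∷ t))) Σ≡0)) i∈t))

    edge-point : (a c : Fin (suc d)) → a F.< c → Σ (Fin n) λ x → vec x ≡ W a ⊕ W c
    edge-point zero    (suc j) _   = β j , sym (⊕-idˡ (b j))
    edge-point (suc i) (suc j) i<j = map₂ proj₂ (sum-in-X (FP.<⇒≢ (NP.≤-pred i<j) ∘ β-inj) (β∉X i) (β∉X j))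

    ends : Fin (E (suc d)) → Fin (suc d) × Fin (suc d)
    ends = endsK (suc d)

    edge-elem : Fin (E (suc d)) → Fin n
    edge-elem e = proj₁ (edge-point (proj₁ (ends e)) (proj₂ (ends e)) (endsK-< (suc d) e))

    edge-elem-vec : ∀ e → vec (edge-elem e) ≡ W (proj₁ (ends e)) ⊕ W (proj₂ (ends e))
    edge-elem-vec e = proj₂ (edge-point (proj₁ (ends e)) (proj₂ (ends e)) (endsK-< (suc d) e))

    -- Different edges give different points: their vertex sets differ away from 0.
    edge-elem-injective : ∀ {e₁ e₂} → edge-elem e₁ ≡ edge-elem e₂ → e₁ ≡ e₂
    edge-elem-injective {e₁} {e₂} fe₁≡fe₂ = endsK-injective (suc d) (cong₂ _,_ (proj₁ same-ends) (proj₂ same-ends))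
      where
      a₁ c₁ a₂ c₂ : Fin (suc d)
      a₁ = proj₁ (ends e₁) ; c₁ = proj₂ (ends e₁) ; a₂ = proj₁ (ends e₂) ; c₂ = proj₂ (ends e₂)
      Σ≡0 : sumV W ((⁅ a₁ ⁆ ⊕ ⁅ c₁ ⁆) ⊕ (⁅ a₂ ⁆ ⊕ ⁅ c₂ ⁆)) ≡ zeroV r
      Σ≡0 = begin
        sumV W ((⁅ a₁ ⁆ ⊕ ⁅ c₁ ⁆) ⊕ (⁅ a₂ ⁆ ⊕ ⁅ c₂ ⁆))  ≡⟨ sumV-lin W (⁅ a₁ ⁆ ⊕ ⁅ c₁ ⁆) (⁅ a₂ ⁆ ⊕ ⁅ c₂ ⁆) ⟩
        sumV W (⁅ a₁ ⁆ ⊕ ⁅ c₁ ⁆) ⊕ sumV W (⁅ a₂ ⁆ ⊕ ⁅ c₂ ⁆)  ≡⟨ cong₂ _⊕_ (sumV-pair W a₁ c₁) (sumV-pair W a₂ c₂) ⟩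
        (W a₁ ⊕ W c₁) ⊕ (W a₂ ⊕ W c₂)                   ≡⟨ cong (_⊕ (W a₂ ⊕ W c₂)) (trans (sym (edge-elem-vec e₁)) (trans (cong vec fe₁≡fe₂) (edge-elem-vec e₂))) ⟩
        (W a₂ ⊕ W c₂) ⊕ (W a₂ ⊕ W c₂)                   ≡⟨ ⊕-self _ ⟩
        zeroV r                                         ∎
        where open ≡-Reasoning
      same-ends : a₁ ≡ a₂ × c₁ ≡ c₂
      same-ends = edge-determined (endsK-< (suc d) e₁) (endsK-< (suc d) e₂) (W-dep _ Σ≡0)

    K : IsoMK rk (image edge-elem ⊤) (suc d)
    K = E (suc d) , ends , completeK (suc d) , edge-elem , edge-elem-injective , refl ,
        GraphicRealisation.graphic vec rk rk≡ ends edge-elem W edge-elem-vec W-dep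

  complete-restriction : (B : Subset n) → B ⊆ D → GF2Indep vec B → HasMK rk (suc ∣ B ∣)
  complete-restriction B B⊆D indepB = image edge-elem ⊤ , K
    where open Frame B B⊆D indepB (enumerate B)

  has-K : HasMK rk (suc (rk D))
  has-K = subst (HasMK rk ∘ suc) card (complete-restriction base ⊆S indep)
    where open Basis (basis (rk≡ D))

  -- Without an M(K₅) restriction, rk D ≤ 3: four independent points of D give one.
  rank-D-≤3 : ¬ HasMK rk 5 → rk D ≤ 3
  rank-D-≤3 noK₅ with rk D N.≤? 3
  ... | yes ≤3 = ≤3
  ... | no ≰3 = absurd (from-four (subset-of-size base 4 (subst (4 ≤_) (sym card) (NP.≰⇒> ≰3))))
    where
    open Basis (basis (rk≡ D))
    from-four : (Σ (Subset n) λ B → B ⊆ base × ∣ B ∣ ≡ 4) → Empty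
    from-four (B , B⊆base , ∣B∣≡4) =
      noK₅ (subst (HasMK rk ∘ suc) ∣B∣≡4 (complete-restriction B (⊆S ∘ B⊆base) (λ U U⊆ → indep U (B⊆base ∘ U⊆))))

split-along : ∀ {n} (U X : Subset n) → U ≡ (U ∩ X) ⊕ (U ∩ ∁ X)
split-along U X = begin
  U                          ≡⟨ sym (SP.∩-identityʳ U) ⟩
  U ∩ ⊤                      ≡⟨ cong (U ∩_) (sym (SP.p∪∁p≡⊤ X)) ⟩
  U ∩ (X ∪ ∁ X)              ≡⟨ SP.∩-distribˡ-∪ U X (∁ X) ⟩
  (U ∩ X) ∪ (U ∩ ∁ X)        ≡⟨ disjoint-∪ _ _ (λ i∈ i∈′ → SP.x∈∁p⇒x∉p (SP.p∩q⊆q U (∁ X) i∈′) (SP.p∩q⊆q U X i∈)) ⟩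
  (U ∩ X) ⊕ (U ∩ ∁ X)        ∎
  where open ≡-Reasoning

two-points : ∀ {n} {B : Subset n} → 2 ≤ ∣ B ∣ → Σ (Fin n) λ t → Σ (Fin n) λ t′ → t ≢ t′ × t ∈ B × t′ ∈ B
two-points {B = B} 2≤ with card>0⇒nonempty B (NP.<-≤-trans (s≤s z≤n) 2≤)
... | t , t∈B with card>0⇒nonempty (B - t) (NP.≤-pred (subst (2 ≤_) (∣p∣≡1+∣p-x∣ B t t∈B) 2≤))
...   | t′ , t′∈ = t , t′ , proj₂ (∈-─ t′∈) , t∈B , proj₁ (∈-─ t′∈)

4+≰3 : ∀ k → ¬ (4 + k ≤ 3)
4+≰3 k (s≤s (s≤s (s≤s ())))

double : ℕ → ℕ
double zero    = zero
double (suc k) = suc (suc (double k))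

module ParallelConnection {n r : ℕ} (M : Matroid n) (vec : Fin n → Vec Bool r)
         (rk≡ : ∀ S → GF2Rank vec S (Matroid.rk M S)) (simple : Simple (Matroid.rk M))
         (X : Subset n) (copoint : Copoint (Matroid.rk M) X) (modular : ModularIn (Matroid.rk M) ⊤ X) where

  open Matroid M
  open Span vec
  open SimpleBinary rk vec rk≡ simple
  open ModularCopoint M vec rk≡ simple X copoint modular

  ∈D⇒∉X : ∀ {x} → x ∈ D → x ∉ X
  ∈D⇒∉X = SP.x∈∁p⇒x∉p

  record Peeled (U : Subset n) (k : ℕ) : Set where
    field
      rest    : Subset n
      rest⊆D  : rest ⊆ D
      ∣rest∣  : ∣ rest ∣ ≡ k
      point   : Fin n
      point∈X : point ∈ X
      sum≡    : sumV vec U ≡ sumV vec rest ⊕ vec point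

  peel-two : ∀ {k} U → ∣ U ∣ ≡ suc (suc k) → U ⊆ D → Peeled U k
  peel-two {k} U ∣U∣≡ U⊆D = first (card>0⇒nonempty U (subst (0 <_) (sym ∣U∣≡) (s≤s z≤n)))
    where
    first : Nonempty U → Peeled U k
    first (t , t∈U) = second (card>0⇒nonempty (U - t) (subst (0 <_) (sym ∣U-t∣≡) (s≤s z≤n)))
      where
      ∣U-t∣≡ : ∣ U - t ∣ ≡ suc k
      ∣U-t∣≡ = ∣p-x∣≡ U t t∈U ∣U∣≡
      second : Nonempty (U - t) → Peeled U k
      second (t′ , t′∈) = record
        { rest = U - t - t′ ; rest⊆D = U⊆D ∘ proj₁ ∘ ∈-─ ∘ proj₁ ∘ ∈-─ ; ∣rest∣ = ∣p-x∣≡ (U - t) t′ t′∈ ∣U-t∣≡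
        ; point = proj₁ sum ; point∈X = proj₁ (proj₂ sum) ; sum≡ = ΣU≡ }
        where
        sum : Σ (Fin n) λ x → x ∈ X × vec x ≡ vec t′ ⊕ vec t
        sum = sum-in-X (λ t′≡t → proj₂ (∈-─ t′∈) (sym t′≡t)) (∈D⇒∉X (U⊆D (proj₁ (∈-─ t′∈)))) (∈D⇒∉X (U⊆D t∈U))
        ΣU≡ : sumV vec U ≡ sumV vec (U - t - t′) ⊕ vec (proj₁ sum)
        ΣU≡ = begin
          sumV vec U                                     ≡⟨ sumV-split-off vec U t t∈U ⟩
          sumV vec (U - t) ⊕ vec t                       ≡⟨ cong (_⊕ vec t) (sumV-split-off vec (U - t) t′ t′∈) ⟩
          (sumV vec (U - t - t′) ⊕ vec t′) ⊕ vec t       ≡⟨ ⊕-assoc _ _ _ ⟩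
          sumV vec (U - t - t′) ⊕ (vec t′ ⊕ vec t)       ≡⟨ cong (sumV vec (U - t - t′) ⊕_) (sym (proj₂ (proj₂ sum))) ⟩
          sumV vec (U - t - t′) ⊕ vec (proj₁ sum)        ∎
          where open ≡-Reasoning

  even-in-span : ∀ k U → ∣ U ∣ ≡ double k → U ⊆ D → InSpan vec X (sumV vec U)
  even-in-span zero    U ∣U∣≡0 _   = subst (InSpan vec X) (sym (trans (cong (sumV vec) (card≡0⇒⊥ U ∣U∣≡0)) (sumV-⊥ vec))) span-zero
  even-in-span (suc k) U ∣U∣≡ U⊆D = subst (InSpan vec X) (sym sum≡) (span-⊕ (even-in-span k rest ∣rest∣ rest⊆D) (span-mem point∈X))
    where open Peeled (peel-two U ∣U∣≡ U⊆D)

  -- An odd sum is not in span X: removing one point t leaves an even sum, which would put t in X.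
  odd-not-in-span : ∀ k U → ∣ U ∣ ≡ suc (double k) → U ⊆ D → ¬ InSpan vec X (sumV vec U)
  odd-not-in-span k U ∣U∣≡ U⊆D ΣU∈ = remove (card>0⇒nonempty U (subst (0 <_) (sym ∣U∣≡) (s≤s z≤n)))
    where
    remove : Nonempty U → Empty
    remove (t , t∈U) = ∈D⇒∉X (U⊆D t∈U) (X-closed (subst (InSpan vec X) vt≡ (span-⊕ ΣU∈ ΣU-t∈)))
      where
      ΣU-t∈ : InSpan vec X (sumV vec (U - t))
      ΣU-t∈ = even-in-span k (U - t) (∣p-x∣≡ U t t∈U ∣U∣≡) (U⊆D ∘ proj₁ ∘ ∈-─)
      vt≡ : sumV vec U ⊕ sumV vec (U - t) ≡ vec t
      vt≡ = begin
        sumV vec U ⊕ sumV vec (U - t)                   ≡⟨ cong (_⊕ sumV vec (U - t)) (trans (sumV-split-off vec U t t∈U) (⊕-comm _ (vec t))) ⟩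
        (vec t ⊕ sumV vec (U - t)) ⊕ sumV vec (U - t)   ≡⟨ ⊕-assoc (vec t) _ _ ⟩
        vec t ⊕ (sumV vec (U - t) ⊕ sumV vec (U - t))   ≡⟨ cong (vec t ⊕_) (⊕-self _) ⟩
        vec t ⊕ zeroV r                                 ≡⟨ ⊕-idʳ (vec t) ⟩
        vec t                                           ∎
        where open ≡-Reasoning

  open Basis (basis (rk≡ D)) public renaming (base to T; ⊆S to T⊆D; indep to T-indep; card to ∣T∣≡rk; spans to T-spans)

  Y : Subset n
  Y = cl T

  Y-span : ∀ {y} → y ∈ Y → InSpan vec T (vec y)
  Y-span = cl⁻

  D⊆Y : D ⊆ Y
  D⊆Y {x} x∈D = cl⁺ (T-spans x x∈D)

  X-or-Y : ∀ x → x ∈ X ⊎ x ∈ Y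
  X-or-Y x with x SP.∈? X
  ... | yes x∈X = inj₁ x∈X
  ... | no x∉X  = inj₂ (D⊆Y (SP.x∉p⇒x∈∁p x∉X))

  X∪Y≡⊤ : X ∪ Y ≡ ⊤
  X∪Y≡⊤ = SP.⊆-antisym SP.⊆⊤ λ {x} _ → SP.x∈p∪q⁺ (X-or-Y x)

  X∩Y-flat-in-X : FlatIn rk X (X ∩ Y)
  X∩Y-flat-in-X = flat-by-span (SP.p∩q⊆p X Y) λ x x∈X x∉ sp →
    x∉ (SP.x∈p∩q⁺ (x∈X , cl⁺ (span-trans (λ y y∈ → Y-span (SP.p∩q⊆q X Y y∈)) sp)))

  X∩Y-flat-in-Y : FlatIn rk Y (X ∩ Y)
  X∩Y-flat-in-Y = flat-by-span (SP.p∩q⊆q X Y) λ x x∈Y x∉ sp →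
    x∉ (SP.x∈p∩q⁺ (X-closed (span-mono (SP.p∩q⊆p X Y) sp) , x∈Y))

  -- X ∩ Y is modular in M|Y: every line L of M|Y meets it.  Of two distinct
  -- points of L, one is in X, or else their sum is in X ∩ Y ∩ L.
  X∩Y-modular-in-Y : ModularIn rk Y (X ∩ Y)
  X∩Y-modular-in-Y = X∩Y-flat-in-Y , λ L L-line _ → meets L L-line
    where
    meets : ∀ L → LineIn rk Y L → Nonempty ((X ∩ Y) ∩ L)
    meets L ((L⊆Y , L-closed) , rk-L) = from-points (two-points (NP.≤-reflexive (sym (trans ∣B∣≡ rk-L))))
      where
      B : Subset n
      B⊆L : B ⊆ L
      ∣B∣≡ : ∣ B ∣ ≡ rk L
      B = proj₁ (proj₁ (rk≡ L))
      B⊆L = proj₁ (proj₂ (proj₁ (rk≡ L)))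
      ∣B∣≡ = proj₂ (proj₂ (proj₂ (proj₁ (rk≡ L))))
      in-all : ∀ {x} → x ∈ X → x ∈ L → Nonempty ((X ∩ Y) ∩ L)
      in-all {x} x∈X x∈L = x , SP.x∈p∩q⁺ (SP.x∈p∩q⁺ (x∈X , L⊆Y x∈L) , x∈L)
      both-outside : ∀ {t t′} → t ≢ t′ → t ∈ L → t′ ∈ L → t ∉ X → t′ ∉ X → Nonempty ((X ∩ Y) ∩ L)
      both-outside {t} {t′} t≢t′ t∈L t′∈L t∉X t′∉X = in-all x∈X x∈L
        where
        sum : Σ (Fin n) λ x → x ∈ X × vec x ≡ vec t ⊕ vec t′
        sum = sum-in-X t≢t′ t∉X t′∉X
        x : Fin n
        x = proj₁ sum
        x∈X : x ∈ X
        x∈X = proj₁ (proj₂ sum)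
        vx≡ : vec x ≡ vec t ⊕ vec t′
        vx≡ = proj₂ (proj₂ sum)
        x∈Y : x ∈ Y
        x∈Y = cl⁺ (subst (InSpan vec T) (sym vx≡) (span-⊕ (Y-span (L⊆Y t∈L)) (Y-span (L⊆Y t′∈L))))
        x∈L : x ∈ L
        x∈L = flat-closed (L⊆Y , L-closed) x∈Y (subst (InSpan vec L) (sym vx≡) (span-⊕ (span-mem t∈L) (span-mem t′∈L)))
      from-points : (Σ (Fin n) λ t → Σ (Fin n) λ t′ → t ≢ t′ × t ∈ B × t′ ∈ B) → Nonempty ((X ∩ Y) ∩ L)
      from-points (t , t′ , t≢t′ , t∈B , t′∈B) with t SP.∈? X | t′ SP.∈? X
      ... | yes t∈X | _          = in-all t∈X (B⊆L t∈B)
      ... | no _    | yes t′∈X   = in-all t′∈X (B⊆L t′∈B)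
      ... | no t∉X  | no t′∉X    = both-outside t≢t′ (B⊆L t∈B) (B⊆L t′∈B) t∉X t′∉X

  flat-restricts : ∀ Z → FlatIn rk ⊤ Z → FlatIn rk X (Z ∩ X) × FlatIn rk Y (Z ∩ Y)
  flat-restricts Z Z-flat = restrict X , restrict Y
    where
    restrict : ∀ E → FlatIn rk E (Z ∩ E)
    restrict E = flat-by-span (SP.p∩q⊆q Z E) λ x x∈E x∉ sp →
      x∉ (SP.x∈p∩q⁺ (flat-closed Z-flat ∈⊤ (span-mono (SP.p∩q⊆p Z E) sp) , x∈E))

  module _ (rk-D≤3 : rk D ≤ 3) where

    -- With rk D ≤ 3, a vector in both span T and span X is 0 or a point of
    -- X ∩ Y: it is a sum of at most 3 points of T, evenly many by parity.
    common-vector : ∀ v → InSpan vec T v → InSpan vec X v → v ≡ zeroV r ⊎ Σ (Fin n) λ f → f ∈ X × f ∈ Y × vec f ≡ v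
    common-vector v (U , U⊆T , ΣU≡v) v∈X = by-size ∣ U ∣ refl
      where
      U⊆D : U ⊆ D
      U⊆D = T⊆D ∘ U⊆T
      ΣU∈X : InSpan vec X (sumV vec U)
      ΣU∈X = subst (InSpan vec X) (sym ΣU≡v) v∈X
      by-size : ∀ s → ∣ U ∣ ≡ s → v ≡ zeroV r ⊎ Σ (Fin n) λ f → f ∈ X × f ∈ Y × vec f ≡ v
      by-size 0 ∣U∣≡ = inj₁ (trans (sym ΣU≡v) (trans (cong (sumV vec) (card≡0⇒⊥ U ∣U∣≡)) (sumV-⊥ vec)))
      by-size 1 ∣U∣≡ = absurd (odd-not-in-span 0 U ∣U∣≡ U⊆D ΣU∈X)
      by-size 2 ∣U∣≡ = inj₂ (point , point∈X , cl⁺ (U , U⊆T , ΣU≡vp) , trans (sym ΣU≡vp) ΣU≡v)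
        where
        open Peeled (peel-two U ∣U∣≡ U⊆D)
        ΣU≡vp : sumV vec U ≡ vec point
        ΣU≡vp = trans sum≡ (trans (cong (λ V → sumV vec V ⊕ vec point) (card≡0⇒⊥ rest ∣rest∣))
                                  (trans (cong (_⊕ vec point) (sumV-⊥ vec)) (⊕-idˡ (vec point))))
      by-size 3 ∣U∣≡ = absurd (odd-not-in-span 1 U ∣U∣≡ U⊆D ΣU∈X)
      by-size (suc (suc (suc (suc s)))) ∣U∣≡ = absurd (4+≰3 s (NP.≤-trans (subst (_≤ ∣ T ∣) ∣U∣≡ (SP.p⊆q⇒∣p∣≤∣q∣ U⊆T)) (NP.≤-trans (NP.≤-reflexive ∣T∣≡rk) rk-D≤3)))

    module _ (Z : Subset n) (ZX-flat : FlatIn rk X (Z ∩ X)) (ZY-flat : FlatIn rk Y (Z ∩ Y)) where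

      to-ZY : ∀ {v} → InSpan vec T v → InSpan vec (Z ∩ X) v → InSpan vec (Z ∩ Y) v
      to-ZY {v} v∈T v∈ZX = from (common-vector v v∈T (span-mono (SP.p∩q⊆q Z X) v∈ZX))
        where
        from : v ≡ zeroV r ⊎ Σ (Fin n) (λ f → f ∈ X × f ∈ Y × vec f ≡ v) → InSpan vec (Z ∩ Y) v
        from (inj₁ v≡0) = subst (InSpan vec (Z ∩ Y)) (sym v≡0) span-zero
        from (inj₂ (f , f∈X , f∈Y , vf≡v)) = subst (InSpan vec (Z ∩ Y)) vf≡v
          (span-mem (SP.x∈p∩q⁺ (SP.p∩q⊆p Z X (flat-closed ZX-flat f∈X (subst (InSpan vec (Z ∩ X)) (sym vf≡v) v∈ZX)) , f∈Y)))

      to-ZX : ∀ {v} → InSpan vec (Z ∩ Y) v → InSpan vec X v → InSpan vec (Z ∩ X) v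
      to-ZX {v} v∈ZY v∈X = from (common-vector v (span-trans (λ y y∈ → Y-span (SP.p∩q⊆q Z Y y∈)) v∈ZY) v∈X)
        where
        from : v ≡ zeroV r ⊎ Σ (Fin n) (λ f → f ∈ X × f ∈ Y × vec f ≡ v) → InSpan vec (Z ∩ X) v
        from (inj₁ v≡0) = subst (InSpan vec (Z ∩ X)) (sym v≡0) span-zero
        from (inj₂ (f , f∈X , f∈Y , vf≡v)) = subst (InSpan vec (Z ∩ X)) vf≡v
          (span-mem (SP.x∈p∩q⁺ (SP.p∩q⊆p Z Y (flat-closed ZY-flat f∈Y (subst (InSpan vec (Z ∩ Y)) (sym vf≡v) v∈ZY)) , f∈X)))

      -- If vec x = a + s with a from Z ∩ X and s from Z ∩ Y, then x ∈ Z.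
      glue : FlatIn rk ⊤ Z
      glue = flat-by-span SP.⊆⊤ λ x _ x∉Z (U , U⊆Z , ΣU≡vx) →
        outside x∉Z (X-or-Y x) (trans (sym ΣU≡vx) (trans (cong (sumV vec) (split-along U X)) (sumV-lin vec _ _)))
                (U ∩ X , (λ i∈ → SP.x∈p∩q⁺ (U⊆Z (SP.p∩q⊆p U X i∈) , SP.p∩q⊆q U X i∈)) , refl)
                (U ∩ D , (λ i∈ → SP.x∈p∩q⁺ (U⊆Z (SP.p∩q⊆p U D i∈) , D⊆Y (SP.p∩q⊆q U D i∈))) , refl)
        where
        outside : ∀ {x a s} → x ∉ Z → x ∈ X ⊎ x ∈ Y → vec x ≡ a ⊕ s → InSpan vec (Z ∩ X) a → InSpan vec (Z ∩ Y) s → Empty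
        outside {x} {a} {s} x∉Z (inj₂ x∈Y) vx≡a⊕s a∈ZX s∈ZY =
          x∉Z (SP.p∩q⊆p Z Y (flat-closed ZY-flat x∈Y (subst (InSpan vec (Z ∩ Y)) (sym vx≡a⊕s) (span-⊕ (to-ZY a∈T a∈ZX) s∈ZY))))
          where
          a∈T : InSpan vec T a
          a∈T = subst (InSpan vec T) (sym (⊕-solve vx≡a⊕s)) (span-⊕ (Y-span x∈Y) (span-trans (λ y y∈ → Y-span (SP.p∩q⊆q Z Y y∈)) s∈ZY))
        outside {x} {a} {s} x∉Z (inj₁ x∈X) vx≡a⊕s a∈ZX s∈ZY =
          x∉Z (SP.p∩q⊆p Z X (flat-closed ZX-flat x∈X (subst (InSpan vec (Z ∩ X)) (sym vx≡a⊕s) (span-⊕ a∈ZX (to-ZX s∈ZY s∈X)))))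
          where
          s∈X : InSpan vec X s
          s∈X = subst (InSpan vec X) (sym (⊕-solve (trans vx≡a⊕s (⊕-comm _ _)))) (span-⊕ (span-mem x∈X) (span-mono (SP.p∩q⊆q Z X) a∈ZX))

    is-parallel-connection : IsParallelConnection rk X Y
    is-parallel-connection = X∪Y≡⊤ , X∩Y-flat-in-X , X∩Y-flat-in-Y , inj₂ X∩Y-modular-in-Y ,
                             λ Z → flat-restricts Z , λ (ZX-flat , ZY-flat) → glue Z ZX-flat ZY-flat

allSubsets? : ∀ {n} {P : Subset n → Set} → (∀ U → Dec (P U)) → Dec (∀ U → P U)
allSubsets? P? with SP.anySubset? (λ U → ¬? (P? U))
... | yes (U , ¬PU) = no λ all → ¬PU (all U)
... | no none       = yes λ U → decidable-stable (P? U) (λ ¬PU → none (U , ¬PU))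

Indep? : ∀ {k s} (g : Fin k → Vec Bool s) (W : Subset k) → Dec (GF2Indep g W)
Indep? {s = s} g W with SP.anySubset? {P = λ U → U ⊆ W × Nonempty U × sumV g U ≡ zeroV s}
                          (λ U → (U SP.⊆? W) ×-dec SP.nonempty? U ×-dec VP.≡-dec B._≟_ (sumV g U) (zeroV s))
... | yes (U , U⊆W , U≠∅ , Σ≡0) = no (λ indep → indep U U⊆W U≠∅ Σ≡0)
... | no none                    = yes (λ U U⊆W U≠∅ Σ≡0 → none (U , U⊆W , U≠∅ , Σ≡0))

Rank? : ∀ {k s} (g : Fin k → Vec Bool s) (S : Subset k) (j : ℕ) → Dec (GF2Rank g S j)
Rank? {k} g S j = witness? ×-dec bound?
  where
  witness? : Dec (Σ (Subset k) λ T → T ⊆ S × GF2Indep g T × ∣ T ∣ ≡ j)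
  witness? = SP.anySubset? (λ T → (T SP.⊆? S) ×-dec Indep? g T ×-dec (∣ T ∣ N.≟ j))
  bound? : Dec (∀ T → T ⊆ S → GF2Indep g T → ∣ T ∣ ≤ j)
  bound? = allSubsets? (λ T → (T SP.⊆? S) →-dec Indep? g T →-dec (∣ T ∣ N.≤? j))

rank-unique : ∀ {k s} {g : Fin k → Vec Bool s} {S a b} → GF2Rank g S a → GF2Rank g S b → a ≡ b
rank-unique ((T₁ , T₁⊆ , indep₁ , ∣T₁∣) , max₁) ((T₂ , T₂⊆ , indep₂ , ∣T₂∣) , max₂) =
  NP.≤-antisym (subst (_≤ _) ∣T₁∣ (max₂ T₁ T₁⊆ indep₁)) (subst (_≤ _) ∣T₂∣ (max₁ T₂ T₂⊆ indep₂))

Injective? : ∀ {m s} (g : Fin m → Vec Bool s) → Dec (∀ i j → g i ≡ g j → i ≡ j)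
Injective? g = FP.all? (λ i → FP.all? (λ j → VP.≡-dec B._≟_ (g i) (g j) →-dec (i F.≟ j)))

point-vec : Fin 1 → Vec Bool 1
point-vec _ = true ∷ []

point-rank : ∀ T j → GF2Rank point-vec T j → pointRank T j
point-rank T j R = rank-unique R (toWitness {a? = allSubsets? (λ T → Rank? point-vec T ∣ T ∣)} tt T)

line-vec : Fin 3 → Vec Bool 2
line-vec zero             = true ∷ false ∷ []
line-vec (suc zero)       = false ∷ true ∷ []
line-vec (suc (suc zero)) = true ∷ true ∷ []

line-vec-injective : ∀ i j → line-vec i ≡ line-vec j → i ≡ j
line-vec-injective = toWitness {a? = Injective? line-vec} tt

line-vec-onto : ∀ c → c ≢ zeroV 2 → Σ (Fin 3) λ i → line-vec i ≡ c
line-vec-onto (false ∷ false ∷ []) c≢0 = absurd (c≢0 refl)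
line-vec-onto (true ∷ false ∷ [])  _   = zero , refl
line-vec-onto (false ∷ true ∷ [])  _   = suc zero , refl
line-vec-onto (true ∷ true ∷ [])   _   = suc (suc zero) , refl

line-rank : ∀ T j → GF2Rank line-vec T j → line3Rank T j
line-rank T j R = rank-unique R (toWitness {a? = allSubsets? (λ T → Rank? line-vec T (∣ T ∣ N.⊓ 2))} tt T)

fano-injective : ∀ i j → fanoVec i ≡ fanoVec j → i ≡ j
fano-injective = toWitness {a? = Injective? fanoVec} tt

fano-onto : ∀ c → c ≢ zeroV 3 → Σ (Fin 7) λ i → fanoVec i ≡ c
fano-onto (false ∷ false ∷ false ∷ []) c≢0 = absurd (c≢0 refl)
fano-onto (false ∷ false ∷ true ∷ [])  _   = zero , refl
fano-onto (false ∷ true ∷ false ∷ [])  _   = suc zero , refl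
fano-onto (false ∷ true ∷ true ∷ [])   _   = suc (suc zero) , refl
fano-onto (true ∷ false ∷ false ∷ [])  _   = suc (suc (suc zero)) , refl
fano-onto (true ∷ false ∷ true ∷ [])   _   = suc (suc (suc (suc zero))) , refl
fano-onto (true ∷ true ∷ false ∷ [])   _   = suc (suc (suc (suc (suc zero)))) , refl
fano-onto (true ∷ true ∷ true ∷ [])    _   = suc (suc (suc (suc (suc (suc zero))))) , refl

iso-map : ∀ {n k} {rk : Subset n → ℕ} {Y : Subset n} {ρ σ : Subset k → ℕ → Set} →
          (∀ T j → ρ T j → σ T j) → RestrictionIso rk Y ρ → RestrictionIso rk Y σ
iso-map ρ⇒σ (f , f-inj , image≡ , ranks) = f , f-inj , image≡ , λ T → ρ⇒σ T _ (ranks T)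

-- The cases rk D = 1, 2, 3 (rk D = 0 is impossible).  Coordinates on Y: every
-- point y of Y = cl T has vec y = Σ_{i ∈ c} b_i for a unique nonzero
-- c ⊆ {0, …, k-1}, and y ∉ X when c has odd size.
module Cases {n r : ℕ} (M : Matroid n) (vec : Fin n → Vec Bool r)
         (rk≡ : ∀ S → GF2Rank vec S (Matroid.rk M S)) (simple : Simple (Matroid.rk M))
         (X : Subset n) (copoint : Copoint (Matroid.rk M) X) (modular : ModularIn (Matroid.rk M) ⊤ X) where

  open Matroid M
  open Span vec
  open SimpleBinary rk vec rk≡ simple
  open ModularCopoint M vec rk≡ simple X copoint modular
  open ParallelConnection M vec rk≡ simple X copoint modular

  module Coordinates {k : ℕ} (enum : Enumeration T k) where

    open Frame T T⊆D T-indep enum public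
    open Enumeration enum public renaming (elem to β; inj to β-inj; member to β∈T; onto to β-onto)

    coords : ∀ {y} → y ∈ Y → Σ (Subset k) λ c → sumV b c ≡ vec y
    coords {y} y∈Y = proj₁ sp , proj₂ (proj₂ sp)
      where
      T-in-b : ∀ x → x ∈ T → InSpan b ⊤ (vec x)
      T-in-b x x∈T with β-onto x x∈T
      ... | i , refl = Span.span-mem b ∈⊤
      sp : InSpan b ⊤ (vec y)
      sp = span-trans T-in-b (Y-span y∈Y)

    coords⁻ : ∀ {y} c → sumV b c ≡ vec y → y ∈ Y
    coords⁻ c Σ≡ = cl⁺ (Span.span-trans b (λ i _ → span-mem (β∈T i)) (c , SP.⊆⊤ , Σ≡))

    coords-nonzero : ∀ {y c} → sumV b c ≡ vec y → c ≢ ⊥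
    coords-nonzero {y} Σ≡ refl = vec-nonzero y (trans (sym Σ≡) (sumV-⊥ b))

    odd-coords : ∀ {y} c j → ∣ c ∣ ≡ suc (double j) → sumV b c ≡ vec y → y ∉ X
    odd-coords {y} c j ∣c∣≡ Σ≡ y∈X = odd-not-in-span j (image β c) ∣image-c∣ image⊆D
      (subst (InSpan vec X) (sym (trans (InjectiveImage.sumV-image β β-inj vec c) Σ≡)) (span-mem y∈X))
      where
      ∣image-c∣ : ∣ image β c ∣ ≡ suc (double j)
      ∣image-c∣ = trans (InjectiveImage.∣image∣ β β-inj c) ∣c∣≡
      image⊆D : image β c ⊆ D
      image⊆D x∈ with ∈-image⁻ β c x∈
      ... | i , _ , refl = T⊆D (β∈T i)

    same-coords : ∀ {x y c} → sumV b c ≡ vec x → sumV b c ≡ vec y → x ≡ y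
    same-coords Σ≡x Σ≡y = vec-injective (trans (sym Σ≡x) Σ≡y)

    module _ {m : ℕ} (f : Fin m → Fin n) (g : Fin m → Vec Bool k)
             (f≡ : ∀ i → vec (f i) ≡ sumV b (g i)) (g-onto : ∀ y c → sumV b c ≡ vec y → Σ (Fin m) λ i → g i ≡ c) where

      image≡Y : image f ⊤ ≡ Y
      image≡Y = SP.⊆-antisym ⊆Y Y⊆
        where
        ⊆Y : image f ⊤ ⊆ Y
        ⊆Y x∈ with ∈-image⁻ f ⊤ x∈
        ... | i , _ , refl = coords⁻ (g i) (sym (f≡ i))
        Y⊆ : Y ⊆ image f ⊤
        Y⊆ {y} y∈Y with coords y∈Y
        ... | c , Σ≡ with g-onto y c Σ≡
        ...   | i , refl = subst (_∈ image f ⊤) (same-coords (sym (f≡ i)) Σ≡) (∈-image⁺ f ⊤ ∈⊤)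

      iso-by-coords : (∀ i j → g i ≡ g j → i ≡ j) → RestrictionIso rk Y (GF2Rank g)
      iso-by-coords g-inj = f , f-inj , image≡Y , λ T′ →
          rank-linear (vec ∘ f) g b b-kernel f≡ (InjectiveImage.rank-image f f-inj (rk≡ (image f T′)))
        where
        f-inj : ∀ {i j} → f i ≡ f j → i ≡ j
        f-inj {i} {j} fi≡fj = g-inj i j (b-sum-injective (trans (sym (f≡ i)) (trans (cong vec fi≡fj) (f≡ j))))

  enum-of-size : ∀ {k} → ∣ T ∣ ≡ k → Enumeration T k
  enum-of-size e = subst (Enumeration T) e (enumerate T)

  -- D is nonempty: otherwise X = E would have the rank of M.
  T-nonempty : ∣ T ∣ ≢ 0
  T-nonempty ∣T∣≡0 = NP.<-irrefl refl (subst (λ Z → suc (rk X) ≤ rk Z) (sym X≡⊤) (NP.≤-reflexive (proj₂ copoint)))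
    where
    D-empty : ∀ {x} → x ∉ D
    D-empty {x} x∈D with T-spans x x∈D
    ... | U , U⊆T , ΣU≡vx = vec-nonzero x (trans (sym ΣU≡vx) (trans (cong (sumV vec) U≡⊥) (sumV-⊥ vec)))
      where
      U≡⊥ : U ≡ ⊥
      U≡⊥ = SP.⊆-antisym (subst (U ⊆_) (card≡0⇒⊥ T ∣T∣≡0) U⊆T) zeroV-⊆
    X≡⊤ : X ≡ ⊤
    X≡⊤ = SP.⊆-antisym SP.⊆⊤ (λ _ → SP.x∉∁p⇒x∈p D-empty)

  module _ (rk-D≤3 : rk D ≤ 3) where

    -- rk D = 1: M|Y is a single point b₀, and X ∩ Y = ∅.
    case-point : ∣ T ∣ ≡ 1 → ParallelConnectionCases rk X
    case-point ∣T∣≡1 = Y , is-parallel-connection rk-D≤3 , inj₁ (X∩Y≡⊥ , iso-map {rk = rk} point-rank iso)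
      where
      open Coordinates (enum-of-size ∣T∣≡1)
      f : Fin 1 → Fin n
      f _ = β zero
      onto : ∀ y c → sumV b c ≡ vec y → Σ (Fin 1) λ i → point-vec i ≡ c
      onto y (true ∷ [])  _  = zero , refl
      onto y (false ∷ []) Σ≡ = absurd (coords-nonzero Σ≡ refl)
      iso : RestrictionIso rk Y (GF2Rank point-vec)
      iso = iso-by-coords f point-vec (λ _ → sym (⊕-idʳ _)) onto (toWitness {a? = Injective? point-vec} tt)
      no-common : ∀ {y} → y ∈ X ∩ Y → Empty
      no-common {y} y∈ = by-coords (coords (SP.p∩q⊆q X Y y∈))
        where
        by-coords : Σ (Subset 1) (λ c → sumV b c ≡ vec y) → Empty
        by-coords ((true ∷ [])  , Σ≡) = odd-coords (true ∷ []) 0 refl Σ≡ (SP.p∩q⊆p X Y y∈)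
        by-coords ((false ∷ []) , Σ≡) = coords-nonzero Σ≡ refl
      X∩Y≡⊥ : X ∩ Y ≡ ⊥
      X∩Y≡⊥ = SP.⊆-antisym (absurd ∘ no-common) zeroV-⊆

    -- rk D = 2: M|Y is the line {b₀, b₁, b₀ + b₁}, meeting X in the point b₀ + b₁.
    case-line : ∣ T ∣ ≡ 2 → ParallelConnectionCases rk X
    case-line ∣T∣≡2 = Y , is-parallel-connection rk-D≤3 , inj₂ (inj₁ (∣X∩Y∣≡1 , iso-map {rk = rk} line-rank iso))
      where
      open Coordinates (enum-of-size ∣T∣≡2)
      β₀≢β₁ : β zero ≢ β (suc zero)
      β₀≢β₁ e with β-inj e
      ... | ()
      sum : Σ (Fin n) λ x → x ∈ X × vec x ≡ vec (β zero) ⊕ vec (β (suc zero))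
      p : Fin n
      p∈X : p ∈ X
      sum = sum-in-X β₀≢β₁ (β∉X zero) (β∉X (suc zero))
      p = proj₁ sum
      p∈X = proj₁ (proj₂ sum)
      p-coords : vec p ≡ sumV b (true ∷ true ∷ [])
      p-coords = trans (proj₂ (proj₂ sum)) (cong (b zero ⊕_) (sym (⊕-idʳ _)))
      f : Fin 3 → Fin n
      f zero             = β zero
      f (suc zero)       = β (suc zero)
      f (suc (suc zero)) = p
      f≡ : ∀ i → vec (f i) ≡ sumV b (line-vec i)
      f≡ zero             = sym (⊕-idʳ _)
      f≡ (suc zero)       = sym (⊕-idʳ _)
      f≡ (suc (suc zero)) = p-coords
      iso : RestrictionIso rk Y (GF2Rank line-vec)
      iso = iso-by-coords f line-vec f≡ (λ y c Σ≡ → line-vec-onto c (coords-nonzero Σ≡)) line-vec-injective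
      common⇒p : ∀ {y} → y ∈ X ∩ Y → y ∈ ⁅ p ⁆
      common⇒p {y} y∈ = by-coords (coords (SP.p∩q⊆q X Y y∈))
        where
        y∈X : y ∈ X
        y∈X = SP.p∩q⊆p X Y y∈
        by-coords : Σ (Subset 2) (λ c → sumV b c ≡ vec y) → y ∈ ⁅ p ⁆
        by-coords ((true ∷ true ∷ [])   , Σ≡) = subst (_∈ ⁅ p ⁆) (same-coords {c = true ∷ true ∷ []} (sym p-coords) Σ≡) (SP.x∈⁅x⁆ p)
        by-coords ((true ∷ false ∷ [])  , Σ≡) = absurd (odd-coords (true ∷ false ∷ []) 0 refl Σ≡ y∈X)
        by-coords ((false ∷ true ∷ [])  , Σ≡) = absurd (odd-coords (false ∷ true ∷ []) 0 refl Σ≡ y∈X)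
        by-coords ((false ∷ false ∷ []) , Σ≡) = absurd (coords-nonzero Σ≡ refl)
      X∩Y≡p : X ∩ Y ≡ ⁅ p ⁆
      X∩Y≡p = SP.⊆-antisym common⇒p (⁅⁆⊆ (SP.x∈p∩q⁺ (p∈X , coords⁻ (true ∷ true ∷ []) (sym p-coords))))
      ∣X∩Y∣≡1 : ∣ X ∩ Y ∣ ≡ 1
      ∣X∩Y∣≡1 = trans (cong ∣_∣ X∩Y≡p) (SP.∣⁅x⁆∣≡1 p)

    -- rk D = 3: the points b_i + b_j of X form the 3-point line X ∩ Y; M|Y is F₇
    -- if b₀ + b₁ + b₂ is a point of M, and M(K₄) otherwise.
    module Plane (∣T∣≡3 : ∣ T ∣ ≡ 3) where

      open Coordinates (enum-of-size ∣T∣≡3)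

      c110 c101 c011 c111 : Subset 3
      c110 = true ∷ true ∷ false ∷ []
      c101 = true ∷ false ∷ true ∷ []
      c011 = false ∷ true ∷ true ∷ []
      c111 = true ∷ true ∷ true ∷ []

      pair-point : ∀ i j c → i ≢ j → vec (β i) ⊕ vec (β j) ≡ sumV b c → Σ (Fin n) λ p → p ∈ X × vec p ≡ sumV b c
      pair-point i j c i≢j e = map₂ (map₂ (λ vp≡ → trans vp≡ e)) (sum-in-X (i≢j ∘ β-inj) (β∉X i) (β∉X j))

      P01 : Σ (Fin n) λ p → p ∈ X × vec p ≡ sumV b c110
      P01 = pair-point zero (suc zero) c110 (λ ()) (cong (b zero ⊕_) (sym (⊕-idʳ (b (suc zero)))))
      P02 : Σ (Fin n) λ p → p ∈ X × vec p ≡ sumV b c101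
      P02 = pair-point zero (suc (suc zero)) c101 (λ ()) (cong (b zero ⊕_) (sym (⊕-idʳ (b (suc (suc zero))))))
      P12 : Σ (Fin n) λ p → p ∈ X × vec p ≡ sumV b c011
      P12 = pair-point (suc zero) (suc (suc zero)) c011 (λ ()) (cong (b (suc zero) ⊕_) (sym (⊕-idʳ (b (suc (suc zero))))))
      p01 p02 p12 : Fin n
      p01 = proj₁ P01
      p02 = proj₁ P02
      p12 = proj₁ P12

      coords-distinct : ∀ {x y c c′} → vec x ≡ sumV b c → vec y ≡ sumV b c′ → c ≢ c′ → x ≢ y
      coords-distinct vx≡ vy≡ c≢c′ x≡y = c≢c′ (b-sum-injective (trans (sym vx≡) (trans (cong vec x≡y) vy≡)))

      p01≢p02 : p01 ≢ p02
      p01≢p02 = coords-distinct {c = c110} {c′ = c101} (proj₂ (proj₂ P01)) (proj₂ (proj₂ P02)) (λ ())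
      p12∉ : p12 ∉ ⁅ p01 ⁆ ∪ ⁅ p02 ⁆
      p12∉ p12∈ = either (∈∪⁅⁆ p12∈)
        where
        either : p12 ∈ ⁅ p01 ⁆ ⊎ p12 ≡ p02 → Empty
        either (inj₁ p12∈p01) = coords-distinct {c = c110} {c′ = c011} (proj₂ (proj₂ P01)) (proj₂ (proj₂ P12)) (λ ()) (sym (SP.x∈⁅y⁆⇒x≡y p01 p12∈p01))
        either (inj₂ p12≡p02) = coords-distinct {c = c011} {c′ = c101} (proj₂ (proj₂ P12)) (proj₂ (proj₂ P02)) (λ ()) p12≡p02

      Line : Subset n
      Line = (⁅ p01 ⁆ ∪ ⁅ p02 ⁆) ∪ ⁅ p12 ⁆

      ∈Line₀₁ : p01 ∈ Line
      ∈Line₀₁ = SP.p⊆p∪q ⁅ p12 ⁆ (SP.p⊆p∪q ⁅ p02 ⁆ (SP.x∈⁅x⁆ p01))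
      ∈Line₀₂ : p02 ∈ Line
      ∈Line₀₂ = SP.p⊆p∪q ⁅ p12 ⁆ (SP.q⊆p∪q ⁅ p01 ⁆ ⁅ p02 ⁆ (SP.x∈⁅x⁆ p02))
      ∈Line₁₂ : p12 ∈ Line
      ∈Line₁₂ = SP.q⊆p∪q (⁅ p01 ⁆ ∪ ⁅ p02 ⁆) ⁅ p12 ⁆ (SP.x∈⁅x⁆ p12)

      -- X ∩ Y consists of the points with two coordinates
      X∩Y≡Line : X ∩ Y ≡ Line
      X∩Y≡Line = SP.⊆-antisym common⇒Line (∪⁅⁆-⊆ (∪⁅⁆-⊆ (⁅⁆⊆ (common {c110} P01)) (common {c101} P02)) (common {c011} P12))
        where
        common : ∀ {c} (P : Σ (Fin n) λ p → p ∈ X × vec p ≡ sumV b c) → proj₁ P ∈ X ∩ Y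
        common {c} (p , p∈X , vp≡) = SP.x∈p∩q⁺ (p∈X , coords⁻ c (sym vp≡))
        common⇒Line : ∀ {y} → y ∈ X ∩ Y → y ∈ Line
        common⇒Line {y} y∈ = by-coords (coords (SP.p∩q⊆q X Y y∈))
          where
          y∈X : y ∈ X
          y∈X = SP.p∩q⊆p X Y y∈
          at : ∀ {c p} → vec p ≡ sumV b c → sumV b c ≡ vec y → p ∈ Line → y ∈ Line
          at vp≡ Σ≡ = subst (_∈ Line) (vec-injective (trans vp≡ Σ≡))
          by-coords : Σ (Subset 3) (λ c → sumV b c ≡ vec y) → y ∈ Line
          by-coords ((false ∷ false ∷ false ∷ []) , Σ≡) = absurd (coords-nonzero Σ≡ refl)
          by-coords ((true ∷ false ∷ false ∷ [])  , Σ≡) = absurd (odd-coords (true ∷ false ∷ false ∷ []) 0 refl Σ≡ y∈X)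
          by-coords ((false ∷ true ∷ false ∷ [])  , Σ≡) = absurd (odd-coords (false ∷ true ∷ false ∷ []) 0 refl Σ≡ y∈X)
          by-coords ((false ∷ false ∷ true ∷ [])  , Σ≡) = absurd (odd-coords (false ∷ false ∷ true ∷ []) 0 refl Σ≡ y∈X)
          by-coords ((true ∷ true ∷ true ∷ [])    , Σ≡) = absurd (odd-coords c111 1 refl Σ≡ y∈X)
          by-coords ((true ∷ true ∷ false ∷ [])   , Σ≡) = at {c110} (proj₂ (proj₂ P01)) Σ≡ ∈Line₀₁
          by-coords ((true ∷ false ∷ true ∷ [])   , Σ≡) = at {c101} (proj₂ (proj₂ P02)) Σ≡ ∈Line₀₂
          by-coords ((false ∷ true ∷ true ∷ [])   , Σ≡) = at {c011} (proj₂ (proj₂ P12)) Σ≡ ∈Line₁₂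

      -- Line is a 3-point line: p12 = p01 + p02
      rank-Line : rk Line ≡ 2
      rank-Line = trans (rank-≡ (rk≡ Line) vec (⁅ p01 ⁆ ∪ ⁅ p02 ⁆) (pair-indep p01≢p02) (λ j j∈ → span-mem (SP.p⊆p∪q ⁅ p12 ⁆ j∈)) spans)
                        (∣pair∣ p01≢p02)
        where
        p01∈ : p01 ∈ ⁅ p01 ⁆ ∪ ⁅ p02 ⁆
        p01∈ = SP.p⊆p∪q ⁅ p02 ⁆ (SP.x∈⁅x⁆ p01)
        p02∈ : p02 ∈ ⁅ p01 ⁆ ∪ ⁅ p02 ⁆
        p02∈ = SP.q⊆p∪q ⁅ p01 ⁆ ⁅ p02 ⁆ (SP.x∈⁅x⁆ p02)
        v12≡ : vec p01 ⊕ vec p02 ≡ vec p12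
        v12≡ = trans (cong₂ _⊕_ (proj₂ (proj₂ P01)) (proj₂ (proj₂ P02))) (trans (sym (sumV-lin b c110 c101)) (sym (proj₂ (proj₂ P12))))
        spans : ∀ x → x ∈ Line → InSpan vec (⁅ p01 ⁆ ∪ ⁅ p02 ⁆) (vec x)
        spans x x∈ = either (∈∪⁅⁆ x∈)
          where
          either : x ∈ ⁅ p01 ⁆ ∪ ⁅ p02 ⁆ ⊎ x ≡ p12 → InSpan vec (⁅ p01 ⁆ ∪ ⁅ p02 ⁆) (vec x)
          either (inj₁ x∈pair) = span-mem x∈pair
          either (inj₂ x≡p12)  = subst (InSpan vec _) (trans v12≡ (cong vec (sym x≡p12))) (span-⊕ (span-mem p01∈) (span-mem p02∈))

      three-point-line : ThreePointLineIn rk Y (X ∩ Y)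
      three-point-line = (X∩Y-flat-in-Y , trans (cong rk X∩Y≡Line) rank-Line) ,
                         trans (cong ∣_∣ X∩Y≡Line) (trans (∣p∪⁅x⁆∣ _ p12 p12∉) (cong suc (∣pair∣ p01≢p02)))

      fano : (Σ (Fin n) λ y → vec y ≡ sumV b c111) → RestrictionIso rk Y fanoRank
      fano (y₇ , vy₇≡) = iso-by-coords f fanoVec f≡ (λ y c Σ≡ → fano-onto c (coords-nonzero Σ≡)) fano-injective
        where
        f : Fin 7 → Fin n
        f zero                                     = β (suc (suc zero))
        f (suc zero)                               = β (suc zero)
        f (suc (suc zero))                         = p12
        f (suc (suc (suc zero)))                   = β zero
        f (suc (suc (suc (suc zero))))             = p02
        f (suc (suc (suc (suc (suc zero)))))       = p01
        f (suc (suc (suc (suc (suc (suc zero)))))) = y₇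
        f≡ : ∀ i → vec (f i) ≡ sumV b (fanoVec i)
        f≡ zero                                     = sym (⊕-idʳ _)
        f≡ (suc zero)                               = sym (⊕-idʳ _)
        f≡ (suc (suc zero))                         = proj₂ (proj₂ P12)
        f≡ (suc (suc (suc zero)))                   = sym (⊕-idʳ _)
        f≡ (suc (suc (suc (suc zero))))             = proj₂ (proj₂ P02)
        f≡ (suc (suc (suc (suc (suc zero)))))       = proj₂ (proj₂ P01)
        f≡ (suc (suc (suc (suc (suc (suc zero)))))) = vy₇≡

      K₄ : ¬ (Σ (Fin n) λ y → vec y ≡ sumV b c111) → IsoMK rk Y 4
      K₄ no-y₇ = subst (λ Z → IsoMK rk Z 4) (image≡Y edge-elem g g≡ onto) K
        where
        g : Fin (E 4) → Subset 3
        g e = V.tail (⁅ proj₁ (ends e) ⁆ ⊕ ⁅ proj₂ (ends e) ⁆)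
        g≡ : ∀ e → vec (edge-elem e) ≡ sumV b (g e)
        g≡ e = trans (edge-elem-vec e) (trans (sym (sumV-pair W (proj₁ (ends e)) (proj₂ (ends e)))) (sumV-W (⁅ proj₁ (ends e) ⁆ ⊕ ⁅ proj₂ (ends e) ⁆)))
        onto : ∀ y c → sumV b c ≡ vec y → Σ (Fin (E 4)) λ e → g e ≡ c
        onto y (false ∷ false ∷ false ∷ []) Σ≡ = absurd (coords-nonzero Σ≡ refl)
        onto y (true ∷ true ∷ true ∷ [])    Σ≡ = absurd (no-y₇ (y , sym Σ≡))
        onto y (true ∷ false ∷ false ∷ [])  _  = zero , refl
        onto y (false ∷ true ∷ false ∷ [])  _  = suc zero , refl
        onto y (false ∷ false ∷ true ∷ [])  _  = suc (suc zero) , refl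
        onto y (true ∷ true ∷ false ∷ [])   _  = suc (suc (suc zero)) , refl
        onto y (true ∷ false ∷ true ∷ [])   _  = suc (suc (suc (suc zero))) , refl
        onto y (false ∷ true ∷ true ∷ [])   _  = suc (suc (suc (suc (suc zero)))) , refl

      case-plane : ParallelConnectionCases rk X
      case-plane = Y , is-parallel-connection rk-D≤3 , choose (FP.any? (λ y → VP.≡-dec B._≟_ (vec y) (sumV b c111)))
        where
        choose : Dec (Σ (Fin n) λ y → vec y ≡ sumV b c111) → _
        choose (yes y₇) = inj₂ (inj₂ (inj₂ (three-point-line , fano y₇)))
        choose (no no-y₇) = inj₂ (inj₂ (inj₁ (three-point-line , K₄ no-y₇)))

    parallel-connection-cases : ParallelConnectionCases rk X
    parallel-connection-cases = by-size ∣ T ∣ refl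
      where
      by-size : ∀ k → ∣ T ∣ ≡ k → ParallelConnectionCases rk X
      by-size 0 ∣T∣≡ = absurd (T-nonempty ∣T∣≡)
      by-size 1 ∣T∣≡ = case-point ∣T∣≡
      by-size 2 ∣T∣≡ = case-line ∣T∣≡
      by-size 3 ∣T∣≡ = Plane.case-plane ∣T∣≡
      by-size (suc (suc (suc (suc k)))) ∣T∣≡ = absurd (4+≰3 k (subst (_≤ 3) (trans (sym ∣T∣≡rk) ∣T∣≡) rk-D≤3))

lemma6p1 : ∀ {n} (M : Matroid n) → Simple (Matroid.rk M) → Binary M →
           (X : Subset n) → Copoint (Matroid.rk M) X → ModularIn (Matroid.rk M) ⊤ X →
           HasMK (Matroid.rk M) (suc (Matroid.rk M (∁ X))) ×
           (¬ HasMK (Matroid.rk M) 5 →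
             Matroid.rk M (∁ X) ≤ 3 × ParallelConnectionCases (Matroid.rk M) X)
lemma6p1 M simple (r , vec , rk≡) X copoint modular =
  has-K , λ noK₅ → rank-D-≤3 noK₅ , parallel-connection-cases (rank-D-≤3 noK₅)
  where
  open ModularCopoint M vec rk≡ simple X copoint modular
  open Cases M vec rk≡ simple X copoint modular
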